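{- Let $m \in \mathbb{N}$ and let $G$ be a subdivision of the star $K_{1,m}$ (i.e., a graph obtained from $K_{1,m}$ by replacing its edges with internally disjoint paths). If $m=1$, then the total graph $T(G)$ is equitably $k$-choosable for every $k \geq 3$. If $m \geq 2$, then $T(G)$ is equitably $k$-choosable for every $k \geq m+1$.
   Context: All graphs are finite and simple. The total graph $T(G)$ of a graph $G$ has vertex set $V(G)\cup E(G)$, two elements being adjacent in $T(G)$ iff they are adjacent or incident in $G$. A $k$-assignment $L$ for a graph $G$ assigns to each vertex $v$ a list $L(v)$ of exactly $k$ colors. An equitable $L$-coloring of $G$ is a proper coloring $f$ of $G$ with $f(v)\in L(v)$ for all $v$ such that each color is used on at most $\lceil |V(G)|/k\rceil$ vertices. $G$ is equitably $k$-choosable if it has an equitable $L$-coloring for every $k$-assignment $L$. -}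

module Defs where

open import Data.Nat using (ℕ; zero; suc; _+_; _∸_; _≤_)
open import Data.Nat.DivMod using (_/_)
open import Data.Nat.Properties using (_≟_)
open import Data.Fin using (Fin; toℕ)
open import Data.Unit using (⊤; tt)
open import Data.Sum using (_⊎_; inj₁; inj₂)
open import Data.Product using (Σ; ∃; _×_; _,_)
open import Data.List using (List; length; map; filter; _++_)
open import Data.List.Membership.Propositional using (_∈_)
open import Data.List.Relation.Unary.Unique.Propositional using (Unique)
open import Relation.Binary.PropositionalEquality using (_≡_; _≢_)
open import Function.Bundles using (_↔_; Inverse; _⇔_)

-- ⌈ n / k ⌉ (junk value 0 for k = 0, never used)
⌈_/_⌉ : ℕ → ℕ → ℕ
⌈ n / zero ⌉  = 0
⌈ n / suc k ⌉ = (n + k) / suc k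

record Graph : Set₁ where
  field
    V  : Set
    E  : Set
    vs : List V
    es : List E
    vs-complete : ∀ v → v ∈ vs
    vs-unique   : Unique vs
    es-complete : ∀ e → e ∈ es
    es-unique   : Unique es
    end₁ end₂ : E → V
    loopless : ∀ e → end₁ e ≢ end₂ e
    no-multi : ∀ e e' →
      ((end₁ e ≡ end₁ e' × end₂ e ≡ end₂ e') ⊎ (end₁ e ≡ end₂ e' × end₂ e ≡ end₁ e'))
      → e ≡ e'

  Adj : V → V → Set
  Adj u v = ∃ λ e → (end₁ e ≡ u × end₂ e ≡ v) ⊎ (end₁ e ≡ v × end₂ e ≡ u)

  Inc : V → E → Set
  Inc v e = (end₁ e ≡ v) ⊎ (end₂ e ≡ v)

module _ (G : Graph) where
  open Graph G

  TV : Set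
  TV = V ⊎ E

  Tvs : List TV
  Tvs = map inj₁ vs ++ map inj₂ es

  TAdj : TV → TV → Set
  TAdj (inj₁ u) (inj₁ v) = Adj u v
  TAdj (inj₁ u) (inj₂ e) = Inc u e
  TAdj (inj₂ e) (inj₁ v) = Inc v e
  TAdj (inj₂ e) (inj₂ f) = (e ≢ f) × (∃ λ v → Inc v e × Inc v f)

IsKAssignment : {W : Set} → ℕ → (W → List ℕ) → Set
IsKAssignment k L = ∀ w → length (L w) ≡ k × Unique (L w)

colourCount : {W : Set} → List W → (W → ℕ) → ℕ → ℕ
colourCount ws f c = length (filter (λ w → f w ≟ c) ws)

record IsEquitableLColouring {W : Set} (ws : List W) (Adj : W → W → Set)
         (k : ℕ) (L : W → List ℕ) (f : W → ℕ) : Set where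
  field
    proper  : ∀ u v → Adj u v → f u ≢ f v
    fromList : ∀ w → f w ∈ L w
    equitable : ∀ c → colourCount ws f c ≤ ⌈ length ws / k ⌉

EquitablyChoosable : {W : Set} → List W → (W → W → Set) → ℕ → Set
EquitablyChoosable ws Adj k =
  ∀ (L : _ → List ℕ) → IsKAssignment k L →
  Σ (_ → ℕ) λ f → IsEquitableLColouring ws Adj k L f

TotalEquitablyChoosable : Graph → ℕ → Set
TotalEquitablyChoosable G k = EquitablyChoosable (Tvs G) (TAdj G) k

-- The canonical subdivision of the star K_{1,m} with path lengths
-- l i ≥ 1 (number of edges of the i-th path).  Vertices: the centre
-- (inj₁ tt) and, for each i, the vertices (i , j) for j < l i, where
-- (i , j) is at distance j+1 from the centre along path i.

SV : (m : ℕ) → (Fin m → ℕ) → Set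
SV m l = ⊤ ⊎ Σ (Fin m) (λ i → Fin (l i))

data SParent {m : ℕ} (l : Fin m → ℕ) : SV m l → SV m l → Set where
  root : ∀ i (j : Fin (l i)) → toℕ j ≡ 0 → SParent l (inj₂ (i , j)) (inj₁ tt)
  step : ∀ i (j j' : Fin (l i)) → toℕ j' ≡ suc (toℕ j) →
         SParent l (inj₂ (i , j')) (inj₂ (i , j))

SAdj : {m : ℕ} (l : Fin m → ℕ) → SV m l → SV m l → Set
SAdj l x y = SParent l x y ⊎ SParent l y x

IsStarSubdivision : ℕ → Graph → Set
IsStarSubdivision m G =
  Σ (Fin m → ℕ) λ l → (∀ i → 1 ≤ l i) ×
  Σ (Graph.V G ↔ SV m l) λ φ →
    ∀ u v → Graph.Adj G u v ⇔ SAdj l (Inverse.to φ u) (Inverse.to φ v)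

module Submission where

-- T(G) is identified with a set of cells: the centre and positions 0, 1, 2, …
-- on every leg, alternating edges and vertices; two cells are adjacent iff
-- they are at distance 1 or 2 on a leg, or one is the centre and the other at
-- position 0 or 1, or both are at position 0.  A configuration (the centre
-- and an initial segment of each leg) is coloured by induction on its size:
-- at most k cells get distinct colours; otherwise a "good removal" deletes
-- cells from the ends of the legs, the rest is coloured inductively, and the
-- removed cells get pairwise distinct colours greedily, listed so that each
-- has fewer excluded colours than list entries.  A colour thus gains at most
-- one cell while ⌈size / k⌉ drops, which is recorded by a "slot" per cell.
-- Both cases of the theorem follow from this for k ≥ 3 and k > m.

open import Defs
open import Data.Nat using (ℕ; _≤_; _+_)
open import Data.Product using (_×_)
open import Relation.Binary.PropositionalEquality using (_≡_)

open import Data.Empty using (⊥; ⊥-elim)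
open import Data.Fin using (Fin; zero; suc; toℕ; fromℕ<)
import Data.Fin.Properties as Fin
open import Data.List using (List; []; _∷_; length; filter; _++_; applyUpTo; map; upTo)
open import Data.List.Membership.Propositional using (_∈_; _∉_; find; lose)
open import Data.List.Membership.Propositional.Properties
  using (∈-filter⁺; ∈-filter⁻; ∈-++⁺ˡ; ∈-++⁺ʳ; ∈-++⁻; ∈-applyUpTo⁺; ∈-applyUpTo⁻; ∈-map⁺; ∈-map⁻; ∈-upTo⁺)
open import Data.List.Properties
  using (filter-notAll; length-++; filter-++; filter-reject; length-filter; length-applyUpTo; length-map; length-upTo)
import Data.List.Relation.Unary.All as All
open import Data.List.Relation.Unary.AllPairs using ([]; _∷_)
open import Data.List.Relation.Unary.Any as Any using (here; there; any?)
open import Data.List.Relation.Unary.Unique.Propositional using (Unique)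
import Data.List.Relation.Unary.Unique.Propositional.Properties as Unique
open import Data.Nat using (zero; suc; _∸_; _*_; _<_; z≤n; s≤s; _<?_; _≤?_; _⊓_)
open import Data.Nat.Divisibility using (∣-refl)
open import Data.Nat.DivMod using (_/_; /-monoˡ-≤; n/n≡1; +-distrib-/-∣ʳ; m≥n⇒m/n>0; m<n*o⇒m/o<n)
open import Data.Nat.Induction using (<-rec)
open import Data.Nat.Properties
open import Algebra.Properties.CommutativeMonoid.Sum +-0-commutativeMonoid using (sum; ∑-distrib-+; sum-cong-≗)
open import Algebra.Properties.CommutativeSemigroup +-commutativeSemigroup using (x∙yz≈y∙xz; xy∙z≈x∙zy; xy∙z≈xz∙y)
open import Data.Product using (Σ; ∃; _,_; proj₁; proj₂)
open import Data.Sum using (_⊎_; inj₁; inj₂)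
import Data.Sum.Properties as Sum
open import Data.Unit using (⊤; tt)
open import Data.Vec.Functional using (updateAt)
open import Data.Vec.Functional.Properties using (updateAt-updates; updateAt-minimal)
open import Function using (const)
open import Function.Bundles using (_↔_; _⇔_; Inverse; Equivalence)
open import Relation.Binary.Definitions using (DecidableEquality)
open import Relation.Binary.PropositionalEquality using (_≢_; refl; sym; trans; cong; cong₂; subst; subst₂; module ≡-Reasoning)
open import Relation.Nullary using (¬_; Dec; yes; no; ¬?)
open import Relation.Nullary.Decidable using (decidable-stable)
open import Relation.Unary using (Decidable)

module _ {A : Set} (_≟_ : DecidableEquality A) where
  open import Data.List.Membership.DecPropositional _≟_ using (_∈?_)

  remove : A → List A → List A
  remove x = filter (λ y → ¬? (y ≟ x))

  ∈-remove : ∀ {x y ys} → y ∈ ys → y ≢ x → y ∈ remove x ys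
  ∈-remove {x} y∈ys y≢x = ∈-filter⁺ (λ y → ¬? (y ≟ x)) y∈ys y≢x

  length-remove : ∀ {x ys} → x ∈ ys → length (remove x ys) < length ys
  length-remove {x} {ys} x∈ys =
    filter-notAll (λ y → ¬? (y ≟ x)) ys (Any.map (λ x≡y y≢x → y≢x (sym x≡y)) x∈ys)

  Unique-⊆-length : ∀ {xs ys} → Unique xs → (∀ {z} → z ∈ xs → z ∈ ys) → length xs ≤ length ys
  Unique-⊆-length {[]} _ _ = z≤n
  Unique-⊆-length {x ∷ xs} {ys} (x∉xs ∷ uxs) xs⊆ys =
    ≤-trans (s≤s (Unique-⊆-length uxs xs⊆ys-x)) (length-remove (xs⊆ys (here refl)))
    where
    xs⊆ys-x : ∀ {z} → z ∈ xs → z ∈ remove x ys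
    xs⊆ys-x z∈xs = ∈-remove (xs⊆ys (there z∈xs)) (λ z≡x → All.lookup x∉xs z∈xs (sym z≡x))

  fresh : ∀ (cs F : List A) → Unique cs → length F < length cs → ∃ λ c → c ∈ cs × c ∉ F
  fresh cs F ucs F<cs with any? (λ c → ¬? (c ∈? F)) cs
  ... | yes some∉F = find some∉F
  ... | no ¬some∉F = ⊥-elim (<⇒≱ F<cs (Unique-⊆-length ucs cs⊆F))
    where
    cs⊆F : ∀ {z} → z ∈ cs → z ∈ F
    cs⊆F {z} z∈cs = decidable-stable (z ∈? F) (λ z∉F → ¬some∉F (lose z∈cs z∉F))

map-unique : ∀ {A B : Set} (g : A → B) {xs} → Unique xs →
             (∀ {x y} → x ∈ xs → y ∈ xs → g x ≡ g y → x ≡ y) → Unique (map g xs)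
map-unique g {[]} _ _ = []
map-unique g {x ∷ xs} (x∉xs ∷ uxs) injective =
  All.tabulate (λ gy∈ same → let (y , y∈xs , gy≡) = ∈-map⁻ g gy∈ in
                  All.lookup x∉xs y∈xs (injective (here refl) (there y∈xs) (trans same gy≡)))
  ∷ map-unique g uxs (λ x∈ y∈ → injective (there x∈) (there y∈))

colour-class-bound : ∀ {W : Set} (ws : List W) → Unique ws → (f slot : W → ℕ) (q : ℕ) →
                     (∀ {w} → w ∈ ws → slot w < q) →
                     (∀ {v w} → v ∈ ws → w ∈ ws → slot v ≡ slot w → f v ≡ f w → v ≡ w) →
                     ∀ c → colourCount ws f c ≤ q
colour-class-bound {W} ws uws f slot q slot<q separated c = begin
  length class              ≡⟨ sym (length-map slot class) ⟩
  length (map slot class)   ≤⟨ Unique-⊆-length _≟_ (map-unique slot (Unique.filter⁺ (λ w → f w ≟ c) uws) separated′) slots⊆ ⟩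
  length (upTo q)           ≡⟨ length-upTo q ⟩
  q                         ∎
  where
  open ≤-Reasoning
  class : List W
  class = filter (λ w → f w ≟ c) ws
  separated′ : ∀ {v w} → v ∈ class → w ∈ class → slot v ≡ slot w → v ≡ w
  separated′ v∈ w∈ same =
    let (v∈ws , fv≡c) = ∈-filter⁻ (λ w → f w ≟ c) v∈
        (w∈ws , fw≡c) = ∈-filter⁻ (λ w → f w ≟ c) w∈
    in separated v∈ws w∈ws same (trans fv≡c (sym fw≡c))
  slots⊆ : ∀ {z} → z ∈ map slot class → z ∈ upTo q
  slots⊆ z∈ = let (w , w∈ , z≡) = ∈-map⁻ slot z∈ in
    subst (_∈ upTo q) (sym z≡) (∈-upTo⁺ (slot<q (proj₁ (∈-filter⁻ (λ w → f w ≟ c) w∈))))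

-- Room k B o xs: when xs is listed after o earlier entries, the entry x at
-- position p has fewer than k colours excluded, counting the B x colours
-- forbidden at x and the o + p colours already spent on earlier entries.
module _ (k : ℕ) {E : Set} where

  Room : (E → ℕ) → ℕ → List E → Set
  Room B o [] = ⊤
  Room B o (x ∷ xs) = (B x + o < k) × Room B (suc o) xs

  Room-mono : ∀ {B₁ B₂ : E → ℕ} {o} xs → (∀ {x} → x ∈ xs → B₁ x ≤ B₂ x) →
              Room B₂ o xs → Room B₁ o xs
  Room-mono [] _ _ = tt
  Room-mono (x ∷ xs) B₁≤B₂ (room-x , room-xs) =
    ≤-<-trans (+-monoˡ-≤ _ (B₁≤B₂ (here refl))) room-x , Room-mono xs (λ p → B₁≤B₂ (there p)) room-xs

  Room-++ : ∀ {B o} xs ys → Room B o xs → Room B (o + length xs) ys → Room B o (xs ++ ys)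
  Room-++ {B} {o} [] ys _ room-ys = subst (λ z → Room B z ys) (+-identityʳ o) room-ys
  Room-++ {B} {o} (x ∷ xs) ys (room-x , room-xs) room-ys =
    room-x , Room-++ xs ys room-xs (subst (λ z → Room B z ys) (+-suc o (length xs)) room-ys)

  Room-uniform : ∀ {B} β o ys → (∀ {x} → x ∈ ys → B x ≤ β) → β + o + length ys ≤ k → Room B o ys
  Room-uniform β o [] _ _ = tt
  Room-uniform {B} β o (y ∷ ys) B≤β room =
    ≤-trans (s≤s (≤-trans (+-monoˡ-≤ o (B≤β (here refl))) (m≤m+n (β + o) (length ys))))
            (≤-trans (≤-reflexive (sym (+-suc (β + o) (length ys)))) room) ,
    Room-uniform β (suc o) ys (λ p → B≤β (there p))
      (≤-trans (≤-reflexive (cong (_+ length ys) (+-suc β o))) (≤-trans (≤-reflexive (sym (+-suc (β + o) (length ys)))) room))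

module Rainbow {E : Set} (_≟E_ : DecidableEquality E) (k : ℕ) (L : E → List ℕ) (Lk : IsKAssignment k L) where

  record RainbowColouring (F : E → List ℕ) (prev : List ℕ) (S : List E) : Set where
    field
      colour    : E → ℕ
      allowed   : ∀ {x} → x ∈ S → colour x ∈ L x
      avoids    : ∀ {x} → x ∈ S → colour x ∉ F x
      new       : ∀ {x} → x ∈ S → colour x ∉ prev
      injective : ∀ {x y} → x ∈ S → y ∈ S → colour x ≡ colour y → x ≡ y

  greedyRainbow : (F : E → List ℕ) (prev : List ℕ) (S : List E) →
                  Room k (λ x → length (F x)) (length prev) S → RainbowColouring F prev S
  greedyRainbow F prev [] _ =
    record { colour = λ _ → 0 ; allowed = λ () ; avoids = λ () ; new = λ () ; injective = λ () }
  greedyRainbow F prev (x ∷ S) (room-x , room-S) = record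
    { colour = colour ; allowed = allowed ; avoids = avoids ; new = new ; injective = injective }
    where
    -- |F x ++ prev| < k = |L x|, so L x has a colour c outside F x ++ prev
    pick : ∃ λ c → c ∈ L x × c ∉ F x ++ prev
    pick = fresh _≟_ (L x) (F x ++ prev) (proj₂ (Lk x))
             (subst₂ _<_ (sym (length-++ (F x))) (sym (proj₁ (Lk x))) room-x)
    c : ℕ
    c = proj₁ pick
    c∈L : c ∈ L x
    c∈L = proj₁ (proj₂ pick)
    c∉F++prev : c ∉ F x ++ prev
    c∉F++prev = proj₂ (proj₂ pick)
    open RainbowColouring (greedyRainbow F (c ∷ prev) S room-S) renaming
      (colour to colour′; allowed to allowed′; avoids to avoids′; new to new′; injective to injective′)

    colour : E → ℕ
    colour y with y ≟E x
    ... | yes _ = c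
    ... | no _ = colour′ y

    split : ∀ {y} → y ∈ x ∷ S → (y ≡ x × colour y ≡ c) ⊎ (y ∈ S × colour y ≡ colour′ y)
    split {y} y∈ with y ≟E x
    ... | yes y≡x = inj₁ (y≡x , refl)
    ... | no y≢x = inj₂ (Any.tail y≢x y∈ , refl)

    allowed : ∀ {y} → y ∈ x ∷ S → colour y ∈ L y
    allowed y∈ with split y∈
    ... | inj₁ (refl , e) = subst (_∈ L x) (sym e) c∈L
    ... | inj₂ (y∈S , e) = subst (_∈ L _) (sym e) (allowed′ y∈S)

    avoids : ∀ {y} → y ∈ x ∷ S → colour y ∉ F y
    avoids y∈ with split y∈
    ... | inj₁ (refl , e) = λ p → c∉F++prev (∈-++⁺ˡ (subst (_∈ F x) e p))
    ... | inj₂ (y∈S , e) = λ p → avoids′ y∈S (subst (_∈ F _) e p)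

    new : ∀ {y} → y ∈ x ∷ S → colour y ∉ prev
    new y∈ with split y∈
    ... | inj₁ (refl , e) = λ p → c∉F++prev (∈-++⁺ʳ (F x) (subst (_∈ prev) e p))
    ... | inj₂ (y∈S , e) = λ p → new′ y∈S (there (subst (_∈ prev) e p))

    injective : ∀ {y z} → y ∈ x ∷ S → z ∈ x ∷ S → colour y ≡ colour z → y ≡ z
    injective y∈ z∈ same with split y∈ | split z∈
    ... | inj₁ (y≡x , _) | inj₁ (z≡x , _) = trans y≡x (sym z≡x)
    ... | inj₁ (_ , ey) | inj₂ (z∈S , ez) = ⊥-elim (new′ z∈S (here (trans (sym ez) (trans (sym same) ey))))
    ... | inj₂ (y∈S , ey) | inj₁ (_ , ez) = ⊥-elim (new′ y∈S (here (trans (sym ey) (trans same ez))))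
    ... | inj₂ (y∈S , ey) | inj₂ (z∈S , ez) = injective′ y∈S z∈S (trans (sym ey) (trans same ez))

measure-rec : ∀ {A : Set} (μ : A → ℕ) (P : A → Set) →
              (∀ a → (∀ b → μ b < μ a → P b) → P a) → ∀ a → P a
measure-rec μ P build a = <-rec (λ c → ∀ a → μ a ≡ c → P a) build′ (μ a) a refl
  where
  build′ : ∀ c → (∀ {c′} → c′ < c → ∀ a → μ a ≡ c′ → P a) → ∀ a → μ a ≡ c → P a
  build′ _ ih a refl = build a (λ b μb<μa → ih μb<μa b refl)

sum-mono-≤ : ∀ {m} {f g : Fin m → ℕ} → (∀ j → f j ≤ g j) → sum f ≤ sum g
sum-mono-≤ {zero} _ = z≤n
sum-mono-≤ {suc m} f≤g = +-mono-≤ (f≤g zero) (sum-mono-≤ (λ j → f≤g (suc j)))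

term≤sum : ∀ {m} (f : Fin m → ℕ) i → f i ≤ sum f
term≤sum {suc m} f zero = m≤m+n (f zero) _
term≤sum {suc m} f (suc i) = ≤-trans (term≤sum (λ j → f (suc j)) i) (m≤n+m _ (f zero))

sum-zero : ∀ {m} (f : Fin m → ℕ) → (∀ j → f j ≡ 0) → sum f ≡ 0
sum-zero {zero} f _ = refl
sum-zero {suc m} f f≡0 = cong₂ _+_ (f≡0 zero) (sum-zero (λ j → f (suc j)) (λ j → f≡0 (suc j)))

nonzero-term : ∀ {m} (f : Fin m → ℕ) → 0 < sum f → ∃ λ i → 0 < f i
nonzero-term f ∑f>0 with Fin.any? (λ i → 0 <? f i)
... | yes found = found
... | no none = ⊥-elim (<⇒≢ ∑f>0 (sym (sum-zero f (λ i → n≤0⇒n≡0 (≮⇒≥ (λ 0<fᵢ → none (i , 0<fᵢ)))))))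

sum-ones : ∀ m → sum {m} (λ _ → 1) ≡ m
sum-ones zero = refl
sum-ones (suc m) = cong suc (sum-ones m)

sum-∸ : ∀ {m} (f g : Fin m → ℕ) → (∀ j → g j ≤ f j) → sum (λ j → f j ∸ g j) + sum g ≡ sum f
sum-∸ f g g≤f = trans (sym (∑-distrib-+ (λ j → f j ∸ g j) g)) (sum-cong-≗ (λ j → m∸n+n≡m (g≤f j)))

concatF : ∀ {m} {A : Set} → (Fin m → List A) → List A
concatF {zero} f = []
concatF {suc m} f = f zero ++ concatF (λ j → f (suc j))

∈-concatF⁺ : ∀ {m} {A : Set} {f : Fin m → List A} {x} j → x ∈ f j → x ∈ concatF f
∈-concatF⁺ {suc m} {f = f} zero p = ∈-++⁺ˡ p
∈-concatF⁺ {suc m} {f = f} (suc j) p = ∈-++⁺ʳ (f zero) (∈-concatF⁺ {f = λ j → f (suc j)} j p)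

∈-concatF⁻ : ∀ {m} {A : Set} (f : Fin m → List A) {x} → x ∈ concatF f → ∃ λ j → x ∈ f j
∈-concatF⁻ {suc m} f p with ∈-++⁻ (f zero) p
... | inj₁ q = zero , q
... | inj₂ q with ∈-concatF⁻ (λ j → f (suc j)) q
... | j , r = suc j , r

count-concatF : ∀ {m} {A : Set} {P : A → Set} (P? : Decidable P) (f : Fin m → List A) →
                length (filter P? (concatF f)) ≡ sum (λ j → length (filter P? (f j)))
count-concatF {zero} P? f = refl
count-concatF {suc m} P? f = begin
  length (filter P? (f zero ++ concatF (λ j → f (suc j))))
    ≡⟨ cong length (filter-++ P? (f zero) _) ⟩
  length (filter P? (f zero) ++ filter P? (concatF (λ j → f (suc j))))
    ≡⟨ length-++ (filter P? (f zero)) ⟩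
  length (filter P? (f zero)) + length (filter P? (concatF (λ j → f (suc j))))
    ≡⟨ cong (length (filter P? (f zero)) +_) (count-concatF P? (λ j → f (suc j))) ⟩
  sum (λ j → length (filter P? (f j))) ∎
  where open ≡-Reasoning

length-concatF : ∀ {m} {A : Set} (f : Fin m → List A) → length (concatF f) ≡ sum (λ j → length (f j))
length-concatF {zero} f = refl
length-concatF {suc m} f = trans (length-++ (f zero)) (cong (length (f zero) +_) (length-concatF (λ j → f (suc j))))

concatF-unique : ∀ {m} {A : Set} (f : Fin m → List A) → (∀ j → Unique (f j)) →
                 (∀ {x} i j → x ∈ f i → x ∈ f j → i ≡ j) → Unique (concatF f)
concatF-unique {zero} f _ _ = []
concatF-unique {suc m} f unique disjoint =
  Unique.++⁺ (unique zero)
    (concatF-unique (λ j → f (suc j)) (λ j → unique (suc j)) (λ i j p q → Fin.suc-injective (disjoint (suc i) (suc j) p q)))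
    (λ (p , q) → zero≢suc (disjoint zero _ p (proj₂ (∈-concatF⁻ (λ j → f (suc j)) q))))
  where
  zero≢suc : ∀ {n} {j : Fin n} → zero ≢ suc j
  zero≢suc ()

-- The total graph of the subdivided star with m legs of unbounded length.
-- A cell is the centre or the t-th element (leg i t) of leg i counted from
-- the centre: even t is the (t/2+1)-st edge and odd t the ((t+1)/2)-th vertex
-- of the path.
data Cell (m : ℕ) : Set where
  centre : Cell m
  leg    : Fin m → ℕ → Cell m

module StarTotalGraph (m : ℕ) where

  _≟C_ : DecidableEquality (Cell m)
  centre ≟C centre = yes refl
  centre ≟C leg _ _ = no (λ ())
  leg _ _ ≟C centre = no (λ ())
  leg i t ≟C leg j u with i Fin.≟ j | t ≟ u
  ... | yes refl | yes refl = yes refl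
  ... | no i≢j | _ = no (λ { refl → i≢j refl })
  ... | _ | no t≢u = no (λ { refl → t≢u refl })

  startIfOther : Fin m → Fin m → List (Cell m)
  startIfOther i j with j Fin.≟ i
  ... | yes _ = []
  ... | no _ = leg j 0 ∷ []

  otherStarts : Fin m → List (Cell m)
  otherStarts i = concatF (startIfOther i)

  ∈-otherStarts⁺ : ∀ {i j} → j ≢ i → leg j 0 ∈ otherStarts i
  ∈-otherStarts⁺ {i} {j} j≢i = ∈-concatF⁺ j start∈
    where
    start∈ : leg j 0 ∈ startIfOther i j
    start∈ with j Fin.≟ i
    ... | yes j≡i = ⊥-elim (j≢i j≡i)
    ... | no _ = here refl

  ∈-otherStarts⁻ : ∀ {i x} → x ∈ otherStarts i → ∃ λ j → x ≡ leg j 0 × j ≢ i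
  ∈-otherStarts⁻ {i} x∈ with ∈-concatF⁻ (startIfOther i) x∈
  ... | j , x∈j = j , inspect j x∈j
    where
    inspect : ∀ j {x} → x ∈ startIfOther i j → x ≡ leg j 0 × j ≢ i
    inspect j x∈j with j Fin.≟ i
    inspect j () | yes _
    inspect j (here x≡) | no j≢i = x≡ , j≢i

  firstTwo : Fin m → List (Cell m)
  firstTwo j = leg j 0 ∷ leg j 1 ∷ []

  neighbours : Cell m → List (Cell m)
  neighbours centre = concatF firstTwo
  neighbours (leg i 0) = leg i 1 ∷ leg i 2 ∷ centre ∷ otherStarts i
  neighbours (leg i 1) = leg i 2 ∷ leg i 3 ∷ leg i 0 ∷ centre ∷ []
  neighbours (leg i (suc (suc t))) =
    leg i (3 + t) ∷ leg i (4 + t) ∷ leg i (1 + t) ∷ leg i t ∷ []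

  neighbours-sym : ∀ {x y} → y ∈ neighbours x → x ∈ neighbours y
  neighbours-sym {centre} y∈ with ∈-concatF⁻ firstTwo y∈
  ... | j , here refl = there (there (here refl))
  ... | j , there (here refl) = there (there (there (here refl)))
  neighbours-sym {leg i 0} (here refl) = there (there (here refl))
  neighbours-sym {leg i 0} (there (here refl)) = there (there (there (here refl)))
  neighbours-sym {leg i 0} (there (there (here refl))) = ∈-concatF⁺ i (here refl)
  neighbours-sym {leg i 0} (there (there (there y∈))) with ∈-otherStarts⁻ y∈
  ... | j , refl , j≢i = there (there (there (∈-otherStarts⁺ (λ i≡j → j≢i (sym i≡j)))))
  neighbours-sym {leg i 1} (here refl) = there (there (here refl))
  neighbours-sym {leg i 1} (there (here refl)) = there (there (there (here refl)))
  neighbours-sym {leg i 1} (there (there (here refl))) = here refl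
  neighbours-sym {leg i 1} (there (there (there (here refl)))) = ∈-concatF⁺ i (there (here refl))
  neighbours-sym {leg i (suc (suc t))} (here refl) = there (there (here refl))
  neighbours-sym {leg i (suc (suc t))} (there (here refl)) = there (there (there (here refl)))
  neighbours-sym {leg i (suc (suc zero))} (there (there (here refl))) = here refl
  neighbours-sym {leg i (suc (suc (suc t)))} (there (there (here refl))) = here refl
  neighbours-sym {leg i (suc (suc zero))} (there (there (there (here refl)))) = there (here refl)
  neighbours-sym {leg i (suc (suc (suc zero)))} (there (there (there (here refl)))) = there (here refl)
  neighbours-sym {leg i (suc (suc (suc (suc t))))} (there (there (there (here refl)))) = there (here refl)

  neighbours-irrefl : ∀ x → x ∉ neighbours x
  neighbours-irrefl centre x∈ with ∈-concatF⁻ firstTwo x∈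
  ... | j , here ()
  ... | j , there (here ())
  neighbours-irrefl (leg i 0) (there (there (there x∈))) with ∈-otherStarts⁻ x∈
  ... | j , refl , j≢i = j≢i refl
  neighbours-irrefl (leg i 1) (there (there (there (there ()))))
  neighbours-irrefl (leg i (suc (suc t))) (there (there (there (there ()))))

atLeast1 : ℕ → ℕ
atLeast1 zero = 0
atLeast1 (suc _) = 1

atLeast2 : ℕ → ℕ
atLeast2 (suc (suc _)) = 1
atLeast2 _ = 0

atLeast1-pos : ∀ {a} → 0 < a → 1 ≤ atLeast1 a
atLeast1-pos {suc a} _ = s≤s z≤n

atLeast2-≤ : ∀ a → atLeast2 a ≤ a
atLeast2-≤ zero = z≤n
atLeast2-≤ (suc zero) = z≤n
atLeast2-≤ (suc (suc a)) = s≤s z≤n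

atLeast2-≤1 : ∀ a → atLeast2 a ≤ 1
atLeast2-≤1 zero = z≤n
atLeast2-≤1 (suc zero) = z≤n
atLeast2-≤1 (suc (suc a)) = s≤s z≤n

atLeast2-pos : ∀ {a} → 2 ≤ a → 1 ≤ atLeast2 a
atLeast2-pos {suc (suc a)} _ = s≤s z≤n
atLeast2-pos {suc zero} (s≤s ())

atLeast2-pos⁻ : ∀ {a} → 1 ≤ atLeast2 a → 2 ≤ a
atLeast2-pos⁻ {suc (suc a)} _ = s≤s (s≤s z≤n)
atLeast2-pos⁻ {zero} ()
atLeast2-pos⁻ {suc zero} ()

≤2⇒≤1+atLeast2 : ∀ {a} → a ≤ 2 → a ≤ 1 + atLeast2 a
≤2⇒≤1+atLeast2 {zero} _ = z≤n
≤2⇒≤1+atLeast2 {suc zero} _ = s≤s z≤n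
≤2⇒≤1+atLeast2 {suc (suc zero)} _ = ≤-refl
≤2⇒≤1+atLeast2 {suc (suc (suc a))} (s≤s (s≤s ()))

atLeast-split : ∀ a → atLeast1 a + atLeast2 a + (a ∸ 2) ≡ a
atLeast-split zero = refl
atLeast-split (suc zero) = refl
atLeast-split (suc (suc a)) = refl

A₁ A₂ : ∀ {m} → (Fin m → ℕ) → ℕ
A₁ s = sum (λ j → atLeast1 (s j))
A₂ s = sum (λ j → atLeast2 (s j))

A₁+A₂+rest : ∀ {m} (s : Fin m → ℕ) → A₁ s + A₂ s + sum (λ j → s j ∸ 2) ≡ sum s
A₁+A₂+rest s = begin
  A₁ s + A₂ s + sum (λ j → s j ∸ 2)
    ≡⟨ cong (_+ sum (λ j → s j ∸ 2)) (sym (∑-distrib-+ (λ j → atLeast1 (s j)) (λ j → atLeast2 (s j)))) ⟩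
  sum (λ j → atLeast1 (s j) + atLeast2 (s j)) + sum (λ j → s j ∸ 2)
    ≡⟨ sym (∑-distrib-+ (λ j → atLeast1 (s j) + atLeast2 (s j)) (λ j → s j ∸ 2)) ⟩
  sum (λ j → atLeast1 (s j) + atLeast2 (s j) + (s j ∸ 2))
    ≡⟨ sum-cong-≗ (λ j → atLeast-split (s j)) ⟩
  sum s ∎
  where open ≡-Reasoning

A₁+A₂≤sum : ∀ {m} (s : Fin m → ℕ) → A₁ s + A₂ s ≤ sum s
A₁+A₂≤sum s = ≤-trans (m≤m+n _ _) (≤-reflexive (A₁+A₂+rest s))

A₂-pos : ∀ {m} (s : Fin m → ℕ) i → 2 ≤ s i → 1 ≤ A₂ s
A₂-pos s i 2≤sᵢ = ≤-trans (atLeast2-pos 2≤sᵢ) (term≤sum (λ j → atLeast2 (s j)) i)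

long-leg-room : ∀ {m} (s : Fin m → ℕ) i → 3 ≤ s i → A₁ s + 2 ≤ sum s × A₁ s + A₂ s + 1 ≤ sum s
long-leg-room s i 3≤sᵢ =
  ≤-trans (≤-reflexive (sym (+-assoc (A₁ s) 1 1)))
          (≤-trans (+-mono-≤ (+-monoʳ-≤ (A₁ s) (A₂-pos s i (≤-trans (n≤1+n 2) 3≤sᵢ))) rest≥1) ∑s≡) ,
  ≤-trans (+-monoʳ-≤ (A₁ s + A₂ s) rest≥1) ∑s≡
  where
  ∑s≡ : A₁ s + A₂ s + sum (λ j → s j ∸ 2) ≤ sum s
  ∑s≡ = ≤-reflexive (A₁+A₂+rest s)
  rest≥1 : 1 ≤ sum (λ j → s j ∸ 2)
  rest≥1 = ≤-trans (∸-monoˡ-≤ 2 3≤sᵢ) (term≤sum (λ j → s j ∸ 2) i)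

-- A configuration n selects the centre and the first n i cells of each leg i.
module Configurations (m : ℕ) where
  open StarTotalGraph m public

  Config : Set
  Config = Fin m → ℕ

  _∈ᶜ_ : Cell m → Config → Set
  centre ∈ᶜ n = ⊤
  leg i t ∈ᶜ n = t < n i

  _∈ᶜ?_ : (x : Cell m) (n : Config) → Dec (x ∈ᶜ n)
  centre ∈ᶜ? n = yes tt
  leg i t ∈ᶜ? n = t <? n i

  countIn : Config → List (Cell m) → ℕ
  countIn n xs = length (filter (_∈ᶜ? n) xs)

  degreeIn : Config → Cell m → ℕ
  degreeIn n x = countIn n (neighbours x)

  nonEmptyLegs : Config → ℕ
  nonEmptyLegs n = sum (λ i → atLeast1 (n i))

  outside : ∀ n j t → n j ≤ t → ¬ (leg j t ∈ᶜ n)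
  outside n j t nj≤t = ≤⇒≯ nj≤t

  skip : ∀ n {a} rest → ¬ (a ∈ᶜ n) → countIn n (a ∷ rest) ≡ countIn n rest
  skip n rest a∉n = cong length (filter-reject (λ x → x ∈ᶜ? n) a∉n)

  skip₂ : ∀ n {a b} rest → ¬ (a ∈ᶜ n) → ¬ (b ∈ᶜ n) → countIn n (a ∷ b ∷ rest) ≤ length rest
  skip₂ n rest a∉ b∉ =
    ≤-trans (≤-reflexive (trans (skip n _ a∉) (skip n rest b∉))) (length-filter (λ x → x ∈ᶜ? n) rest)

  skip₃ : ∀ n {a b c} rest → ¬ (a ∈ᶜ n) → ¬ (b ∈ᶜ n) → ¬ (c ∈ᶜ n) → countIn n (a ∷ b ∷ c ∷ rest) ≤ length rest
  skip₃ n {a} rest a∉ b∉ c∉ = ≤-trans (≤-reflexive (skip n _ a∉)) (skip₂ n rest b∉ c∉)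

  degree-start₀ : ∀ n j → n j ≡ 0 → degreeIn n (leg j 0) ≤ suc (nonEmptyLegs n)
  degree-start₀ n j nj≡0 = begin
    degreeIn n (leg j 0)
      ≡⟨ trans (skip n _ (outside n j 1 n≤)) (skip n _ (outside n j 2 n≤)) ⟩
    suc (countIn n (otherStarts j))
      ≡⟨ cong suc (count-concatF (λ x → x ∈ᶜ? n) (startIfOther j)) ⟩
    suc (sum (λ i → countIn n (startIfOther j i)))
      ≤⟨ s≤s (sum-mono-≤ start-count) ⟩
    suc (nonEmptyLegs n) ∎
    where
    open ≤-Reasoning
    n≤ : ∀ {t} → n j ≤ t
    n≤ = ≤-trans (≤-reflexive nj≡0) z≤n
    start-count : ∀ i → countIn n (startIfOther j i) ≤ atLeast1 (n i)
    start-count i with i Fin.≟ j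
    ... | yes _ = z≤n
    ... | no _ with 0 <? n i
    ...   | yes 0<ni = ≤-trans (length-filter (λ x → x ∈ᶜ? n) (leg i 0 ∷ [])) (atLeast1-pos 0<ni)
    ...   | no 0≮ni = ≤-trans (≤-reflexive (skip n [] 0≮ni)) z≤n

  degree-start : ∀ n j t → n j ≡ suc t → degreeIn n (leg j (suc t)) ≤ 2
  degree-start n j zero nj≡1 =
    skip₂ n _ (outside n j 2 (≤-trans (≤-reflexive nj≡1) (s≤s z≤n))) (outside n j 3 (≤-trans (≤-reflexive nj≡1) (s≤s z≤n)))
  degree-start n j (suc t) nj≡ =
    skip₂ n _ (outside n j _ (≤-trans (≤-reflexive nj≡) (n≤1+n _))) (outside n j _ (≤-trans (≤-reflexive nj≡) (m≤n+m _ 2)))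

  degree-second : ∀ n j → degreeIn n (leg j (suc (n j))) ≤ 1
  degree-second n j with n j in nj≡
  ... | zero = skip₃ n _ (outside n j 2 n≤) (outside n j 3 n≤) (outside n j 0 n≤)
    where n≤ : ∀ {t} → n j ≤ t
          n≤ = ≤-trans (≤-reflexive nj≡) z≤n
  ... | suc t = skip₃ n _ (outside n j _ (≤-trans (≤-reflexive nj≡) (m≤n+m _ 2)))
                          (outside n j _ (≤-trans (≤-reflexive nj≡) (m≤n+m _ 3)))
                          (outside n j _ (≤-reflexive nj≡))

  degree-far : ∀ n j u → degreeIn n (leg j (2 + (n j + u))) ≡ 0
  degree-far n j u =
    trans (skip n _ (far 3)) (trans (skip n _ (far 4)) (trans (skip n _ (far 1)) (skip n [] (far 0))))
    where
    far : ∀ d → ¬ (leg j (d + (n j + u)) ∈ᶜ n)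
    far d = outside n j _ (≤-trans (m≤m+n (n j) u) (m≤n+m _ d))

  size : Config → ℕ
  size n = suc (sum n)

  legCells : Config → Fin m → List (Cell m)
  legCells n j = applyUpTo (leg j) (n j)

  cells : Config → List (Cell m)
  cells n = centre ∷ concatF (legCells n)

  length-cells : ∀ n → length (cells n) ≡ size n
  length-cells n = cong suc (trans (length-concatF (legCells n)) (sum-cong-≗ (λ j → length-applyUpTo (leg j) (n j))))

  ∈-cells⁺ : ∀ n {x} → x ∈ᶜ n → x ∈ cells n
  ∈-cells⁺ n {centre} _ = here refl
  ∈-cells⁺ n {leg j t} t<nⱼ = there (∈-concatF⁺ j (∈-applyUpTo⁺ (leg j) t<nⱼ))

  ∈-cells⁻ : ∀ n {x} → x ∈ cells n → x ∈ᶜ n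
  ∈-cells⁻ n (here refl) = tt
  ∈-cells⁻ n (there x∈) with ∈-concatF⁻ (legCells n) x∈
  ... | j , x∈j with ∈-applyUpTo⁻ (leg j) x∈j
  ...   | t , t<nⱼ , refl = t<nⱼ

  cells-unique : ∀ n → Unique (cells n)
  cells-unique n = All.tabulate centre-fresh ∷ concatF-unique (legCells n) legCells-unique legCells-disjoint
    where
    centre-fresh : ∀ {x} → x ∈ concatF (legCells n) → centre ≢ x
    centre-fresh x∈ refl with ∈-concatF⁻ (legCells n) x∈
    ... | j , x∈j with ∈-applyUpTo⁻ (leg j) x∈j
    ...   | _ , _ , ()
    legCells-unique : ∀ j → Unique (legCells n j)
    legCells-unique j = Unique.applyUpTo⁺₁ (leg j) (n j) (λ t<u _ same → <⇒≢ t<u (leg-injective same))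
      where leg-injective : ∀ {t u} → leg j t ≡ leg j u → t ≡ u
            leg-injective refl = refl
    legCells-disjoint : ∀ {x} i j → x ∈ legCells n i → x ∈ legCells n j → i ≡ j
    legCells-disjoint i j x∈i x∈j with ∈-applyUpTo⁻ (leg i) x∈i | ∈-applyUpTo⁻ (leg j) x∈j
    ... | _ , _ , refl | _ , _ , refl = refl

  -- Removing s j ≤ n j cells from the end of every leg of n leaves
  -- n′ = n ∸ s.  On leg j the removed cells are the positions
  -- n′ j, n′ j + 1, …, n j − 1, and we split them into four kinds according
  -- to the number of their neighbours in n′ (a = s j, u = n′ j):
  --   the first removed cell when the leg becomes empty   (startAt0,    ≤ 1 + #non-empty legs),
  --   the first removed cell when the leg stays non-empty (startAfter,  ≤ 2),
  --   the second removed cell                             (second,      ≤ 1),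
  --   all further removed cells                           (far,         0).
  startAt0 startAfter second far : ℕ → ℕ → Fin m → List (Cell m)
  startAt0 (suc _) zero j = leg j 0 ∷ []
  startAt0 _ _ _ = []
  startAfter (suc _) (suc u) j = leg j (suc u) ∷ []
  startAfter _ _ _ = []
  second (suc (suc _)) u j = leg j (suc u) ∷ []
  second _ _ _ = []
  far a u j = applyUpTo (λ t → leg j (2 + (u + t))) (a ∸ 2)

  classify : ∀ a u d j → d < a → let x = leg j (u + d) in
             x ∈ startAt0 a u j ⊎ x ∈ startAfter a u j ⊎ x ∈ second a u j ⊎ x ∈ far a u j
  classify (suc a) zero zero j _ = inj₁ (here refl)
  classify (suc a) (suc u) zero j _ = inj₂ (inj₁ (here (cong (leg j) (+-identityʳ (suc u)))))
  classify (suc (suc a)) u (suc zero) j _ = inj₂ (inj₂ (inj₁ (here (cong (leg j) (+-comm u 1)))))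
  classify (suc zero) u (suc d) j (s≤s ())
  classify (suc (suc a)) u (suc (suc d)) j (s≤s (s≤s d<a)) = inj₂ (inj₂ (inj₂
    (subst (λ t → leg j t ∈ far (suc (suc a)) u j) (sym (trans (+-suc u (suc d)) (cong suc (+-suc u d))))
      (∈-applyUpTo⁺ (λ t → leg j (2 + (u + t))) d<a))))

  startAt0+startAfter : ∀ a u j → length (startAt0 a u j) + length (startAfter a u j) ≡ atLeast1 a
  startAt0+startAfter zero u j = refl
  startAt0+startAfter (suc a) zero j = refl
  startAt0+startAfter (suc a) (suc u) j = refl

  startAt0-or-nonEmpty : ∀ a u j → length (startAt0 a u j) + atLeast1 u ≤ 1
  startAt0-or-nonEmpty zero zero j = z≤n
  startAt0-or-nonEmpty zero (suc u) j = s≤s z≤n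
  startAt0-or-nonEmpty (suc a) zero j = s≤s z≤n
  startAt0-or-nonEmpty (suc a) (suc u) j = s≤s z≤n

  length-second : ∀ a u j → length (second a u j) ≡ atLeast2 a
  length-second zero u j = refl
  length-second (suc zero) u j = refl
  length-second (suc (suc a)) u j = refl

  module Removal (n s : Config) (s≤n : ∀ j → s j ≤ n j) where

    n′ : Config
    n′ j = n j ∸ s j

    kind : (ℕ → ℕ → Fin m → List (Cell m)) → List (Cell m)
    kind K = concatF (λ j → K (s j) (n′ j) j)

    removed : List (Cell m)
    removed = kind startAt0 ++ kind startAfter ++ kind second ++ kind far

    removed-complete : ∀ x → x ∈ᶜ n → ¬ (x ∈ᶜ n′) → x ∈ removed
    removed-complete centre _ ∉n′ = ⊥-elim (∉n′ tt)
    removed-complete (leg j t) t<n ∉n′ =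
      subst (_∈ removed) (cong (leg j) (m+[n∸m]≡n n′≤t)) (inject (classify (s j) (n′ j) (t ∸ n′ j) j d<s))
      where
      n′≤t : n′ j ≤ t
      n′≤t = ≮⇒≥ ∉n′
      d<s : t ∸ n′ j < s j
      d<s = +-cancelˡ-< (n′ j) (t ∸ n′ j) (s j)
              (subst₂ _<_ (sym (m+[n∸m]≡n n′≤t)) (sym (m∸n+n≡m (s≤n j))) t<n)
      inject : ∀ {x} → x ∈ startAt0 (s j) (n′ j) j ⊎ x ∈ startAfter (s j) (n′ j) j ⊎
               x ∈ second (s j) (n′ j) j ⊎ x ∈ far (s j) (n′ j) j → x ∈ removed
      inject (inj₁ p) = ∈-++⁺ˡ (∈-concatF⁺ j p)
      inject (inj₂ (inj₁ p)) = ∈-++⁺ʳ (kind startAt0) (∈-++⁺ˡ (∈-concatF⁺ j p))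
      inject (inj₂ (inj₂ (inj₁ p))) = ∈-++⁺ʳ (kind startAt0) (∈-++⁺ʳ (kind startAfter) (∈-++⁺ˡ (∈-concatF⁺ j p)))
      inject (inj₂ (inj₂ (inj₂ p))) = ∈-++⁺ʳ (kind startAt0) (∈-++⁺ʳ (kind startAfter) (∈-++⁺ʳ (kind second) (∈-concatF⁺ j p)))

    W P O R : ℕ
    W = length (kind startAt0)
    P = length (kind startAfter)
    O = length (kind second)
    R = length (kind far)

    W+P≡A₁ : W + P ≡ A₁ s
    W+P≡A₁ = begin
      W + P
        ≡⟨ cong₂ _+_ (length-concatF (λ j → startAt0 (s j) (n′ j) j)) (length-concatF (λ j → startAfter (s j) (n′ j) j)) ⟩
      sum (λ j → length (startAt0 (s j) (n′ j) j)) + sum (λ j → length (startAfter (s j) (n′ j) j))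
        ≡⟨ sym (∑-distrib-+ (λ j → length (startAt0 (s j) (n′ j) j)) (λ j → length (startAfter (s j) (n′ j) j))) ⟩
      sum (λ j → length (startAt0 (s j) (n′ j) j) + length (startAfter (s j) (n′ j) j))
        ≡⟨ sum-cong-≗ (λ j → startAt0+startAfter (s j) (n′ j) j) ⟩
      A₁ s ∎
      where open ≡-Reasoning

    O≡A₂ : O ≡ A₂ s
    O≡A₂ = trans (length-concatF (λ j → second (s j) (n′ j) j)) (sum-cong-≗ (λ j → length-second (s j) (n′ j) j))

    R≡ : R ≡ sum (λ j → s j ∸ 2)
    R≡ = trans (length-concatF (λ j → far (s j) (n′ j) j)) (sum-cong-≗ (λ j → length-applyUpTo _ (s j ∸ 2)))

    W+P+O+R≡∑s : W + P + O + R ≡ sum s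
    W+P+O+R≡∑s = trans (cong₂ _+_ (cong₂ _+_ W+P≡A₁ O≡A₂) R≡) (A₁+A₂+rest s)

    -- each leg contributes a startAt0 cell or a non-empty remaining leg, not both
    W+nonEmpty≤m : W + nonEmptyLegs n′ ≤ m
    W+nonEmpty≤m = begin
      W + nonEmptyLegs n′
        ≡⟨ cong (_+ nonEmptyLegs n′) (length-concatF (λ j → startAt0 (s j) (n′ j) j)) ⟩
      sum (λ j → length (startAt0 (s j) (n′ j) j)) + nonEmptyLegs n′
        ≡⟨ sym (∑-distrib-+ (λ j → length (startAt0 (s j) (n′ j) j)) (λ j → atLeast1 (n′ j))) ⟩
      sum (λ j → length (startAt0 (s j) (n′ j) j) + atLeast1 (n′ j))
        ≤⟨ sum-mono-≤ (λ j → startAt0-or-nonEmpty (s j) (n′ j) j) ⟩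
      sum {m} (λ _ → 1)
        ≡⟨ sum-ones m ⟩
      m ∎
      where open ≤-Reasoning

    -- Room for each kind, given that its cells have at most
    -- 1 + #non-empty legs, 2, 1, resp. 0 coloured neighbours and are listed
    -- after the cells of the earlier kinds.
    room₀ : ∀ k → m < k → Room k (degreeIn n′) 0 (kind startAt0)
    room₀ k m<k = Room-uniform k (suc (nonEmptyLegs n′)) 0 _ bound
      (≤-trans (≤-reflexive (cong suc (trans (cong (_+ W) (+-identityʳ _)) (+-comm _ W)))) (≤-trans (s≤s W+nonEmpty≤m) m<k))
      where
      bound : ∀ {x} → x ∈ kind startAt0 → degreeIn n′ x ≤ suc (nonEmptyLegs n′)
      bound x∈ with ∈-concatF⁻ (λ j → startAt0 (s j) (n′ j) j) x∈
      ... | j , x∈j = bound′ (s j) (n′ j) refl x∈j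
        where
        bound′ : ∀ a u → u ≡ n′ j → ∀ {x} → x ∈ startAt0 a u j → degreeIn n′ x ≤ suc (nonEmptyLegs n′)
        bound′ (suc a) zero 0≡n′ (here refl) = degree-start₀ n′ j (sym 0≡n′)

    room₁ : ∀ k → A₁ s + 2 ≤ k → Room k (degreeIn n′) (0 + W) (kind startAfter)
    room₁ k A₁+2≤k = Room-uniform k 2 (0 + W) _ bound
      (≤-trans (≤-reflexive (trans (+-assoc 2 W P) (trans (cong (2 +_) W+P≡A₁) (+-comm 2 (A₁ s))))) A₁+2≤k)
      where
      bound : ∀ {x} → x ∈ kind startAfter → degreeIn n′ x ≤ 2
      bound x∈ with ∈-concatF⁻ (λ j → startAfter (s j) (n′ j) j) x∈
      ... | j , x∈j = bound′ (s j) (n′ j) refl x∈j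
        where
        bound′ : ∀ a u → u ≡ n′ j → ∀ {x} → x ∈ startAfter a u j → degreeIn n′ x ≤ 2
        bound′ (suc a) (suc u) u≡n′ (here refl) = degree-start n′ j u (sym u≡n′)

    room₂ : ∀ k → A₁ s + A₂ s + 1 ≤ k → Room k (degreeIn n′) (0 + W + P) (kind second)
    room₂ k A₁+A₂+1≤k = Room-uniform k 1 (0 + W + P) _ bound
      (≤-trans (≤-reflexive (trans (cong₂ (λ a b → 1 + a + b) W+P≡A₁ O≡A₂) (+-comm 1 (A₁ s + A₂ s)))) A₁+A₂+1≤k)
      where
      bound : ∀ {x} → x ∈ kind second → degreeIn n′ x ≤ 1
      bound x∈ with ∈-concatF⁻ (λ j → second (s j) (n′ j) j) x∈
      ... | j , x∈j = bound′ (s j) x∈j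
        where
        bound′ : ∀ a {x} → x ∈ second a (n′ j) j → degreeIn n′ x ≤ 1
        bound′ (suc (suc a)) (here refl) = degree-second n′ j

    room₃ : ∀ k → sum s ≤ k → Room k (degreeIn n′) (0 + W + P + O) (kind far)
    room₃ k ∑s≤k = Room-uniform k 0 (0 + W + P + O) _ bound (≤-trans (≤-reflexive W+P+O+R≡∑s) ∑s≤k)
      where
      bound : ∀ {x} → x ∈ kind far → degreeIn n′ x ≤ 0
      bound x∈ with ∈-concatF⁻ (λ j → far (s j) (n′ j) j) x∈
      ... | j , x∈j with ∈-applyUpTo⁻ (λ t → leg j (2 + (n′ j + t))) x∈j
      ...   | u , _ , refl = ≤-reflexive (degree-far n′ j u)

    removed-room : ∀ k → m < k → A₁ s + 2 ≤ k → A₁ s + A₂ s + 1 ≤ k → sum s ≤ k → Room k (degreeIn n′) 0 removed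
    removed-room k m<k A₁+2≤k A₁+A₂+1≤k ∑s≤k =
      Room-++ k (kind startAt0) _ (room₀ k m<k)
        (Room-++ k (kind startAfter) _ (room₁ k A₁+2≤k)
          (Room-++ k (kind second) (kind far) (room₂ k A₁+A₂+1≤k) (room₃ k ∑s≤k)))

module Ceiling (k′ : ℕ) where
  private
    k : ℕ
    k = suc k′

  ⌈+k/k⌉ : ∀ a → ⌈ a + k / k ⌉ ≡ suc ⌈ a / k ⌉
  ⌈+k/k⌉ a = begin
    (a + k + k′) / k        ≡⟨ cong (_/ k) (xy∙z≈xz∙y a k k′) ⟩
    (a + k′ + k) / k        ≡⟨ +-distrib-/-∣ʳ (a + k′) ∣-refl ⟩
    (a + k′) / k + k / k    ≡⟨ cong ((a + k′) / k +_) (n/n≡1 k) ⟩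
    (a + k′) / k + 1        ≡⟨ +-comm _ 1 ⟩
    suc ((a + k′) / k)      ∎
    where open ≡-Reasoning

  ⌈/⌉-mono : ∀ {a b} → a ≤ b → ⌈ a / k ⌉ ≤ ⌈ b / k ⌉
  ⌈/⌉-mono a≤b = /-monoˡ-≤ k (+-monoˡ-≤ k′ a≤b)

  ⌈/⌉-pos : ∀ {a} → 0 < a → 1 ≤ ⌈ a / k ⌉
  ⌈/⌉-pos {suc a} _ = m≥n⇒m/n>0 (s≤s (m≤n+m k′ a))

  ⌈/⌉-≤1 : ∀ {a} → a ≤ k → ⌈ a / k ⌉ ≤ 1
  ⌈/⌉-≤1 {a} a≤k = ≤-pred (m<n*o⇒m/o<n {a + k′} {2} (≤-trans (s≤s (+-monoˡ-≤ k′ a≤k)) (≤-reflexive 1+k+k′≡2k)))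
    where
    1+k+k′≡2k : suc (k + k′) ≡ 2 * k
    1+k+k′≡2k = sym (trans (cong (k +_) (+-identityʳ k)) (+-suc k k′))

  ⌈/⌉-≥2 : ∀ {a} → k < a → 2 ≤ ⌈ a / k ⌉
  ⌈/⌉-≥2 {a} k<a = begin
    2                       ≤⟨ s≤s (⌈/⌉-pos (m<n⇒0<n∸m k<a)) ⟩
    suc ⌈ a ∸ k / k ⌉       ≡⟨ sym (⌈+k/k⌉ (a ∸ k)) ⟩
    ⌈ a ∸ k + k / k ⌉       ≡⟨ cong ⌈_/ k ⌉ (m∸n+n≡m (<⇒≤ k<a)) ⟩
    ⌈ a / k ⌉               ∎
    where open ≤-Reasoning

fill : ∀ {m} → (Fin m → ℕ) → ℕ → Fin m → ℕ
fill {suc m} v b zero = v zero ⊓ b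
fill {suc m} v b (suc j) = fill (λ j → v (suc j)) (b ∸ (v zero ⊓ b)) j

fill-≤ : ∀ {m} (v : Fin m → ℕ) b j → fill v b j ≤ v j
fill-≤ {suc m} v b zero = m⊓n≤m (v zero) b
fill-≤ {suc m} v b (suc j) = fill-≤ (λ j → v (suc j)) _ j

sum-fill : ∀ {m} (v : Fin m → ℕ) b → b ≤ sum v → sum (fill v b) ≡ b
sum-fill {zero} v zero z≤n = refl
sum-fill {suc m} v b b≤∑v = begin
  v zero ⊓ b + sum (fill rest (b ∸ (v zero ⊓ b)))   ≡⟨ cong (v zero ⊓ b +_) (sum-fill rest _ remaining≤) ⟩
  v zero ⊓ b + (b ∸ (v zero ⊓ b))                  ≡⟨ m+[n∸m]≡n (m⊓n≤n (v zero) b) ⟩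
  b                                                ∎
  where
  open ≡-Reasoning
  rest : Fin m → ℕ
  rest j = v (suc j)
  remaining≤ : b ∸ (v zero ⊓ b) ≤ sum rest
  remaining≤ with ≤-total (v zero) b
  ... | inj₁ v₀≤b = subst (λ z → b ∸ z ≤ sum rest) (sym (m≤n⇒m⊓n≡m v₀≤b))
                      (subst (b ∸ v zero ≤_) (m+n∸m≡n (v zero) _) (∸-monoˡ-≤ (v zero) b≤∑v))
  ... | inj₂ b≤v₀ = subst (λ z → b ∸ z ≤ sum rest) (sym (m≥n⇒m⊓n≡n b≤v₀)) (≤-trans (≤-reflexive (n∸n≡0 b)) z≤n)

sum-updateAt : ∀ {m} (f : Fin m → ℕ) i g → sum (updateAt f i g) + f i ≡ g (f i) + sum f
sum-updateAt {suc m} f zero g = xy∙z≈x∙zy (g (f zero)) (sum (λ j → f (suc j))) (f zero)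
sum-updateAt {suc m} f (suc i) g = begin
  f zero + sum (updateAt rest i g) + f (suc i)     ≡⟨ +-assoc (f zero) _ _ ⟩
  f zero + (sum (updateAt rest i g) + f (suc i))   ≡⟨ cong (f zero +_) (sum-updateAt rest i g) ⟩
  f zero + (g (f (suc i)) + sum rest)             ≡⟨ x∙yz≈y∙xz (f zero) (g (f (suc i))) (sum rest) ⟩
  g (f (suc i)) + (f zero + sum rest)             ∎
  where
  open ≡-Reasoning
  rest : Fin m → ℕ
  rest j = f (suc j)

fillAround : ∀ {m} → (Fin m → ℕ) → Fin m → ℕ → ℕ → Fin m → ℕ
fillAround v i a b = updateAt (fill (updateAt v i (const 0)) b) i (const a)

fillAround-at : ∀ {m} (v : Fin m → ℕ) i a b → fillAround v i a b i ≡ a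
fillAround-at v i a b = updateAt-updates i (fill (updateAt v i (const 0)) b)

fillAround-off : ∀ {m} (v : Fin m → ℕ) i a b j → j ≢ i → fillAround v i a b j ≤ v j
fillAround-off v i a b j j≢i = begin
  fillAround v i a b j   ≡⟨ updateAt-minimal j i (fill v₀ b) j≢i ⟩
  fill v₀ b j            ≤⟨ fill-≤ v₀ b j ⟩
  v₀ j                   ≡⟨ updateAt-minimal j i v j≢i ⟩
  v j                    ∎
  where
  open ≤-Reasoning
  v₀ : Fin _ → ℕ
  v₀ = updateAt v i (const 0)

sum-fillAround : ∀ {m} (v : Fin m → ℕ) i a b → b + v i ≤ sum v → sum (fillAround v i a b) ≡ a + b
sum-fillAround v i a b b+vᵢ≤∑v = begin
  sum (updateAt ŝ i (const a))       ≡⟨ sym (+-identityʳ _) ⟩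
  sum (updateAt ŝ i (const a)) + 0   ≡⟨ cong (sum (updateAt ŝ i (const a)) +_) (sym ŝᵢ≡0) ⟩
  sum (updateAt ŝ i (const a)) + ŝ i ≡⟨ sum-updateAt ŝ i (const a) ⟩
  a + sum ŝ                          ≡⟨ cong (a +_) (sum-fill v₀ b b≤∑v₀) ⟩
  a + b                              ∎
  where
  open ≡-Reasoning
  v₀ ŝ : Fin _ → ℕ
  v₀ = updateAt v i (const 0)
  ŝ = fill v₀ b
  ŝᵢ≡0 : ŝ i ≡ 0
  ŝᵢ≡0 = n≤0⇒n≡0 (≤-trans (fill-≤ v₀ b i) (≤-reflexive (updateAt-updates i v)))
  b≤∑v₀ : b ≤ sum v₀
  b≤∑v₀ = +-cancelʳ-≤ (v i) b (sum v₀) (≤-trans b+vᵢ≤∑v (≤-reflexive (sym (sum-updateAt v i (const 0)))))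

module Removals (m d : ℕ) (m<k : m < 3 + d) where
  open Configurations m
  open Ceiling (2 + d)

  k : ℕ
  k = 3 + d

  -- the admissible size of the colour classes of n
  capacity : Config → ℕ
  capacity n = ⌈ size n / k ⌉

  size-split : ∀ n s → (∀ j → s j ≤ n j) → size n ≡ size (λ j → n j ∸ s j) + sum s
  size-split n s s≤n = cong suc (sym (sum-∸ n s s≤n))

  -- A removal pattern s for n whose removed cells can be coloured greedily
  -- (Removal.removed-room) and after which the capacity drops.
  record GoodRemoval (n : Config) : Set where
    field
      s              : Config
      s≤n            : ∀ j → s j ≤ n j
      A₁-room        : A₁ s + 2 ≤ k
      A₂-room        : A₁ s + A₂ s + 1 ≤ k
      total-room     : sum s ≤ k
      capacity-drops : capacity (λ j → n j ∸ s j) < capacity n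

  -- If some leg i has at least 3 cells, remove k cells, as many as
  -- possible from leg i; then the capacity drops by exactly one.
  removeAroundLongLeg : ∀ n i → 3 ≤ n i → k ≤ sum n → GoodRemoval n
  removeAroundLongLeg n i 3≤nᵢ k≤∑n = record
    { s = s ; s≤n = s≤n
    ; A₁-room = subst (A₁ s + 2 ≤_) ∑s≡k (proj₁ rooms)
    ; A₂-room = subst (A₁ s + A₂ s + 1 ≤_) ∑s≡k (proj₂ rooms)
    ; total-room = ≤-reflexive ∑s≡k
    ; capacity-drops = ≤-reflexive (sym capacity-step) }
    where
    a : ℕ
    a = n i ⊓ k
    s : Config
    s = fillAround n i a (k ∸ a)
    sᵢ≡a : s i ≡ a
    sᵢ≡a = fillAround-at n i a (k ∸ a)
    s≤n : ∀ j → s j ≤ n j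
    s≤n j with j Fin.≟ i
    ... | yes refl = ≤-trans (≤-reflexive sᵢ≡a) (m⊓n≤m (n i) k)
    ... | no j≢i = fillAround-off n i a (k ∸ a) j j≢i
    fits : k ∸ a + n i ≤ sum n
    fits with ≤-total (n i) k
    ... | inj₁ nᵢ≤k = ≤-trans (≤-reflexive (trans (cong (λ z → k ∸ z + n i) (m≤n⇒m⊓n≡m nᵢ≤k)) (m∸n+n≡m nᵢ≤k))) k≤∑n
    ... | inj₂ k≤nᵢ = ≤-trans (≤-reflexive (trans (cong (λ z → k ∸ z + n i) (m≥n⇒m⊓n≡n k≤nᵢ)) (cong (_+ n i) (n∸n≡0 k))))
                              (term≤sum n i)
    ∑s≡k : sum s ≡ k
    ∑s≡k = trans (sum-fillAround n i a (k ∸ a) fits) (m+[n∸m]≡n (m⊓n≤n (n i) k))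
    rooms : A₁ s + 2 ≤ sum s × A₁ s + A₂ s + 1 ≤ sum s
    rooms = long-leg-room s i (subst (3 ≤_) (sym sᵢ≡a) (⊓-glb 3≤nᵢ (s≤s (s≤s (s≤s z≤n)))))
    capacity-step : capacity n ≡ suc (capacity (λ j → n j ∸ s j))
    capacity-step = trans (cong ⌈_/ k ⌉ (trans (size-split n s s≤n) (cong (size (λ j → n j ∸ s j) +_) ∑s≡k)))
                          (⌈+k/k⌉ (size (λ j → n j ∸ s j)))

  -- When all legs are short, the surplus cells come from the legs of length 2.
  module ShortLegs (n : Config) (n≤2 : ∀ i → n i ≤ 2) (k<size : k < size n) where

    doubleLegs : ℕ
    doubleLegs = sum (λ j → atLeast2 (n j))

    surplus : ℕ
    surplus = size n ∸ k

    -- hence the surplus can be taken from the ends of legs of length 2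
    ∑n≤m+doubleLegs : sum n ≤ m + doubleLegs
    ∑n≤m+doubleLegs = begin
      sum n                                ≤⟨ sum-mono-≤ (λ j → ≤2⇒≤1+atLeast2 (n≤2 j)) ⟩
      sum (λ j → 1 + atLeast2 (n j))       ≡⟨ ∑-distrib-+ {m} (λ _ → 1) (λ j → atLeast2 (n j)) ⟩
      sum {m} (λ _ → 1) + doubleLegs       ≡⟨ cong (_+ doubleLegs) (sum-ones m) ⟩
      m + doubleLegs                       ∎
      where open ≤-Reasoning

    doubleLegs≤m : doubleLegs ≤ m
    doubleLegs≤m = ≤-trans (sum-mono-≤ (λ j → atLeast2-≤1 (n j))) (≤-reflexive (sum-ones m))

    surplus≤doubleLegs : surplus ≤ doubleLegs
    surplus≤doubleLegs = begin
      size n ∸ k                  ≤⟨ ∸-monoˡ-≤ k (s≤s ∑n≤m+doubleLegs) ⟩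
      suc (m + doubleLegs) ∸ k    ≤⟨ ∸-monoˡ-≤ k (+-monoˡ-≤ doubleLegs m<k) ⟩
      k + doubleLegs ∸ k          ≡⟨ m+n∸m≡n k doubleLegs ⟩
      doubleLegs                  ∎
      where open ≤-Reasoning

    drops-to-one : ∀ (s : Config) → (∀ j → s j ≤ n j) → size (λ j → n j ∸ s j) ≤ k →
                   capacity (λ j → n j ∸ s j) < capacity n
    drops-to-one s _ size≤k = ≤-trans (s≤s (⌈/⌉-≤1 size≤k)) (⌈/⌉-≥2 k<size)

    -- A small surplus: remove the last cell of surplus many legs of length 2.
    removeLastCells : surplus ≤ suc d → GoodRemoval n
    removeLastCells small = record
      { s = s ; s≤n = s≤n
      ; A₁-room = ≤-trans (+-monoˡ-≤ 2 (≤-trans (m≤m+n (A₁ s) (A₂ s)) A₁+A₂≤surplus))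
                          (≤-trans (+-monoˡ-≤ 2 small) (≤-reflexive (+-comm (suc d) 2)))
      ; A₂-room = ≤-trans (+-monoˡ-≤ 1 A₁+A₂≤surplus)
                          (≤-trans (+-monoˡ-≤ 1 small) (≤-trans (≤-reflexive (+-comm (suc d) 1)) (n≤1+n _)))
      ; total-room = ≤-trans (≤-reflexive ∑s≡) (≤-trans small (m≤n+m (suc d) 2))
      ; capacity-drops = drops-to-one s s≤n (≤-reflexive size≡k) }
      where
      s : Config
      s = fill (λ j → atLeast2 (n j)) surplus
      s≤n : ∀ j → s j ≤ n j
      s≤n j = ≤-trans (fill-≤ (λ j → atLeast2 (n j)) surplus j) (atLeast2-≤ (n j))
      ∑s≡ : sum s ≡ surplus
      ∑s≡ = sum-fill (λ j → atLeast2 (n j)) surplus surplus≤doubleLegs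
      A₁+A₂≤surplus : A₁ s + A₂ s ≤ surplus
      A₁+A₂≤surplus = ≤-trans (A₁+A₂≤sum s) (≤-reflexive ∑s≡)
      size≡k : size (λ j → n j ∸ s j) ≡ k
      size≡k = +-cancelʳ-≡ surplus _ k (trans (trans (cong (size (λ j → n j ∸ s j) +_) (sym ∑s≡)) (sym (size-split n s s≤n)))
                                             (sym (m+[n∸m]≡n (<⇒≤ k<size))))

    -- A large surplus: remove one leg of length 2 entirely and the last
    -- cell of d further legs of length 2.
    removeLegAndLastCells : suc d < surplus → GoodRemoval n
    removeLegAndLastCells large = record
      { s = s ; s≤n = s≤n
      ; A₁-room = ≤-trans (≤-reflexive (+-comm (A₁ s) 2)) (s≤s (≤-trans (≤-reflexive (+-comm 1 (A₁ s))) A₁+1≤))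
      ; A₂-room = ≤-trans (+-monoˡ-≤ 1 (≤-trans (A₁+A₂≤sum s) (≤-reflexive ∑s≡))) (≤-reflexive (+-comm (2 + d) 1))
      ; total-room = ≤-trans (≤-reflexive ∑s≡) (n≤1+n _)
      ; capacity-drops = drops-to-one s s≤n size≤k }
      where
      doubleLegs≥ : 2 + d ≤ doubleLegs
      doubleLegs≥ = ≤-trans large surplus≤doubleLegs
      i₀ : Fin m
      i₀ = proj₁ (nonzero-term (λ j → atLeast2 (n j)) (≤-trans (s≤s z≤n) doubleLegs≥))
      2≤nᵢ₀ : 2 ≤ n i₀
      2≤nᵢ₀ = atLeast2-pos⁻ (proj₂ (nonzero-term (λ j → atLeast2 (n j)) (≤-trans (s≤s z≤n) doubleLegs≥)))
      s : Config
      s = fillAround (λ j → atLeast2 (n j)) i₀ 2 d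
      s≤n : ∀ j → s j ≤ n j
      s≤n j with j Fin.≟ i₀
      ... | yes refl = ≤-trans (≤-reflexive (fillAround-at (λ j → atLeast2 (n j)) i₀ 2 d)) 2≤nᵢ₀
      ... | no j≢i₀ = ≤-trans (fillAround-off (λ j → atLeast2 (n j)) i₀ 2 d j j≢i₀) (atLeast2-≤ (n j))
      ∑s≡ : sum s ≡ 2 + d
      ∑s≡ = sum-fillAround (λ j → atLeast2 (n j)) i₀ 2 d
              (≤-trans (+-monoʳ-≤ d (atLeast2-≤1 (n i₀))) (≤-trans (≤-reflexive (+-comm d 1)) (≤-trans (n≤1+n _) doubleLegs≥)))
      A₁+1≤ : A₁ s + 1 ≤ 2 + d
      A₁+1≤ = ≤-trans (+-monoʳ-≤ (A₁ s) (A₂-pos s i₀ (≤-reflexive (sym (fillAround-at (λ j → atLeast2 (n j)) i₀ 2 d)))))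
                      (≤-trans (A₁+A₂≤sum s) (≤-reflexive ∑s≡))
      size≤k : size (λ j → n j ∸ s j) ≤ k
      size≤k = +-cancelʳ-≤ (2 + d) _ k (begin
        size (λ j → n j ∸ s j) + (2 + d)   ≡⟨ cong (size (λ j → n j ∸ s j) +_) (sym ∑s≡) ⟩
        size (λ j → n j ∸ s j) + sum s     ≡⟨ sym (size-split n s s≤n) ⟩
        suc (sum n)                        ≤⟨ s≤s (≤-trans ∑n≤m+doubleLegs (+-monoʳ-≤ m doubleLegs≤m)) ⟩
        suc (m + m)                        ≤⟨ s≤s (+-mono-≤ (≤-pred m<k) (≤-pred m<k)) ⟩
        k + (2 + d)                        ∎)
        where open ≤-Reasoning

    removal : GoodRemoval n
    removal with surplus ≤? suc d
    ... | yes small = removeLastCells small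
    ... | no large = removeLegAndLastCells (≰⇒> large)

  goodRemoval : ∀ n → k < size n → GoodRemoval n
  goodRemoval n k<size with Fin.any? (λ i → 3 ≤? n i)
  ... | yes (i , 3≤nᵢ) = removeAroundLongLeg n i 3≤nᵢ (≤-pred k<size)
  ... | no noLongLeg = ShortLegs.removal n (λ i → ≤-pred (≰⇒> (λ 3≤nᵢ → noLongLeg (i , 3≤nᵢ)))) k<size

module Colourings (m d : ℕ) (m<k : m < 3 + d) (L : Cell m → List ℕ) (Lk : IsKAssignment (3 + d) L) where
  open Configurations m
  open Removals m d m<k
  open Rainbow _≟C_ k L Lk
  open Ceiling (2 + d) using (⌈/⌉-pos)

  -- A proper L-colouring of the cells of n together with a slot below
  -- capacity n for every cell, the slots being distinct within each colour
  -- class; so no colour is used more than capacity n times.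
  record Colouring (n : Config) : Set where
    field
      colour slot : Cell m → ℕ
      proper    : ∀ {x y} → x ∈ᶜ n → y ∈ᶜ n → y ∈ neighbours x → colour x ≢ colour y
      fromList  : ∀ {x} → x ∈ᶜ n → colour x ∈ L x
      separated : ∀ {x y} → x ∈ᶜ n → y ∈ᶜ n → slot x ≡ slot y → colour x ≡ colour y → x ≡ y
      slot<     : ∀ {x} → x ∈ᶜ n → slot x < capacity n

  -- At most k cells: give all of them distinct colours and slot 0.
  colourSmall : ∀ n → size n ≤ k → Colouring n
  colourSmall n size≤k = record
    { colour = colour ; slot = λ _ → 0
    ; proper = λ {x} x∈n y∈n y∈nb same → neighbours-irrefl x
        (subst (_∈ neighbours x) (sym (injective (∈-cells⁺ n x∈n) (∈-cells⁺ n y∈n) same)) y∈nb)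
    ; fromList = λ x∈n → allowed (∈-cells⁺ n x∈n)
    ; separated = λ x∈n y∈n _ same → injective (∈-cells⁺ n x∈n) (∈-cells⁺ n y∈n) same
    ; slot< = λ _ → ⌈/⌉-pos {size n} (s≤s z≤n) }
    where
    open RainbowColouring (greedyRainbow (λ _ → []) [] (cells n)
      (Room-uniform k 0 0 (cells n) (λ _ → z≤n) (≤-trans (≤-reflexive (length-cells n)) size≤k)))

  -- Extend a colouring of the remaining configuration n′ = n ∸ s of a good
  -- removal: the removed cells get pairwise distinct colours avoiding their
  -- coloured neighbours (greedy rainbow lemma), all in the new slot capacity n′.
  extend : ∀ n (r : GoodRemoval n) → Colouring (λ j → n j ∸ GoodRemoval.s r j) → Colouring n
  extend n r c′ = record
    { colour = colour ; slot = slot ; proper = proper ; fromList = fromList ; separated = separated ; slot< = slot< }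
    where
    open GoodRemoval r
    open Removal n s s≤n
    open Colouring c′ renaming (colour to colour′; slot to slot′; proper to proper′; fromList to fromList′;
                                separated to separated′; slot< to slot<′)

    forbidden : Cell m → List ℕ
    forbidden x = map colour′ (filter (_∈ᶜ? n′) (neighbours x))

    forbidden⁺ : ∀ {x y} → y ∈ᶜ n′ → y ∈ neighbours x → colour′ y ∈ forbidden x
    forbidden⁺ y∈n′ y∈nb = ∈-map⁺ colour′ (∈-filter⁺ (_∈ᶜ? n′) y∈nb y∈n′)

    open RainbowColouring (greedyRainbow forbidden [] removed
      (Room-mono k removed (λ {x} _ → ≤-reflexive (length-map colour′ (filter (_∈ᶜ? n′) (neighbours x))))
        (removed-room k m<k A₁-room A₂-room total-room)))
      renaming (colour to newColour)

    colour slot : Cell m → ℕ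
    colour x with x ∈ᶜ? n′
    ... | yes _ = colour′ x
    ... | no _ = newColour x
    slot x with x ∈ᶜ? n′
    ... | yes _ = slot′ x
    ... | no _ = capacity n′

    -- an old and a new cell differ since the new colour avoids the old neighbours;
    -- two new cells differ since the new colours are pairwise distinct
    proper : ∀ {x y} → x ∈ᶜ n → y ∈ᶜ n → y ∈ neighbours x → colour x ≢ colour y
    proper {x} {y} x∈n y∈n y∈nb with x ∈ᶜ? n′ | y ∈ᶜ? n′
    ... | yes x∈n′ | yes y∈n′ = proper′ x∈n′ y∈n′ y∈nb
    ... | no x∉n′ | yes y∈n′ = λ same →
          avoids (removed-complete x x∈n x∉n′) (subst (_∈ forbidden x) (sym same) (forbidden⁺ {x} y∈n′ y∈nb))
    ... | yes x∈n′ | no y∉n′ = λ same →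
          avoids (removed-complete y y∈n y∉n′) (subst (_∈ forbidden y) same (forbidden⁺ {y} x∈n′ (neighbours-sym y∈nb)))
    ... | no x∉n′ | no y∉n′ = λ same → neighbours-irrefl x
          (subst (_∈ neighbours x) (sym (injective (removed-complete x x∈n x∉n′) (removed-complete y y∈n y∉n′) same)) y∈nb)

    fromList : ∀ {x} → x ∈ᶜ n → colour x ∈ L x
    fromList {x} x∈n with x ∈ᶜ? n′
    ... | yes x∈n′ = fromList′ x∈n′
    ... | no x∉n′ = allowed (removed-complete x x∈n x∉n′)

    -- old slots lie below capacity n′, the slot of all new cells
    separated : ∀ {x y} → x ∈ᶜ n → y ∈ᶜ n → slot x ≡ slot y → colour x ≡ colour y → x ≡ y
    separated {x} {y} x∈n y∈n same-slot same with x ∈ᶜ? n′ | y ∈ᶜ? n′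
    ... | yes x∈n′ | yes y∈n′ = separated′ x∈n′ y∈n′ same-slot same
    ... | no x∉n′ | no y∉n′ = injective (removed-complete x x∈n x∉n′) (removed-complete y y∈n y∉n′) same
    ... | yes x∈n′ | no _ = ⊥-elim (<-irrefl same-slot (slot<′ x∈n′))
    ... | no _ | yes y∈n′ = ⊥-elim (<-irrefl (sym same-slot) (slot<′ y∈n′))

    slot< : ∀ {x} → x ∈ᶜ n → slot x < capacity n
    slot< {x} _ with x ∈ᶜ? n′
    ... | yes x∈n′ = <-trans (slot<′ x∈n′) capacity-drops
    ... | no _ = capacity-drops

  -- A good removal removes at least one cell, since the capacity changes.
  removal-shrinks : ∀ n (r : GoodRemoval n) → sum (λ j → n j ∸ GoodRemoval.s r j) < sum n
  removal-shrinks n r = ≤∧≢⇒< (sum-mono-≤ (λ j → m∸n≤m (n j) (s j)))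
    (λ same → <-irrefl (cong (λ c → ⌈ suc c / k ⌉) same) capacity-drops)
    where open GoodRemoval r

  colouring : ∀ n → Colouring n
  colouring = measure-rec sum Colouring build
    where
    build : ∀ n → (∀ n′ → sum n′ < sum n → Colouring n′) → Colouring n
    build n ih with size n ≤? k
    ... | yes small = colourSmall n small
    ... | no large = extend n r (ih _ (removal-shrinks n r))
      where r : GoodRemoval n
            r = goodRemoval n (≰⇒> large)

-- Positions along a leg: the j-th vertex of a path (j counted from 0) sits
-- at position 2j+1, the edge joining it to its parent at position 2j.
double : ℕ → ℕ
double zero = zero
double (suc a) = suc (suc (double a))

double-< : ∀ {a b} → a < b → double a < double b
double-< {zero} {suc b} _ = s≤s z≤n
double-< {suc a} {suc b} (s≤s a<b) = s≤s (s≤s (double-< a<b))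

double-<⁻ : ∀ {a b} → double a < double b → a < b
double-<⁻ {zero} {suc b} _ = s≤s z≤n
double-<⁻ {suc a} {suc b} (s≤s (s≤s lt)) = s≤s (double-<⁻ lt)

1+double-< : ∀ {a b} → a < b → suc (double a) < double b
1+double-< {zero} {suc b} _ = s≤s (s≤s z≤n)
1+double-< {suc a} {suc b} (s≤s a<b) = s≤s (s≤s (1+double-< a<b))

1+double-<⁻ : ∀ {a b} → suc (double a) < double b → a < b
1+double-<⁻ {zero} {suc b} _ = s≤s z≤n
1+double-<⁻ {suc a} {suc b} (s≤s (s≤s lt)) = s≤s (1+double-<⁻ lt)

data Parity : ℕ → Set where
  even : ∀ a → Parity (double a)
  odd  : ∀ a → Parity (suc (double a))

parity : ∀ t → Parity t
parity zero = even zero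
parity (suc zero) = odd zero
parity (suc (suc t)) with parity t
... | even a = even (suc a)
... | odd a = odd (suc a)

parity-even : ∀ a → parity (double a) ≡ even a
parity-even zero = refl
parity-even (suc a) rewrite parity-even a = refl

parity-odd : ∀ a → parity (suc (double a)) ≡ odd a
parity-odd zero = refl
parity-odd (suc a) rewrite parity-odd a = refl

module StarCodes (m : ℕ) (l : Fin m → ℕ) where
  open StarTotalGraph m

  code : SV m l → Cell m
  code (inj₁ tt) = centre
  code (inj₂ (i , j)) = leg i (suc (double (toℕ j)))

  -- every edge is given by its endpoint farther from the centre
  child : ∀ {a b} → SParent l a b → Σ (Fin m) (λ i → Fin (l i))
  child (root i j _) = i , j
  child (step i j j' _) = i , j'

  child-≡ : ∀ {a b} (p : SParent l a b) → a ≡ inj₂ (child p)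
  child-≡ (root i j _) = refl
  child-≡ (step i j j' _) = refl

  edgeCode : ∀ {a b} → SParent l a b → Cell m
  edgeCode p = leg (proj₁ (child p)) (double (toℕ (proj₂ (child p))))

-- parents are one step closer to the centre, hence unique and never children of their children
  depth : SV m l → ℕ
  depth (inj₁ _) = 0
  depth (inj₂ (i , j)) = suc (toℕ j)

  depth-parent : ∀ {a b} → SParent l a b → depth a ≡ suc (depth b)
  depth-parent (root i j toℕj≡0) = cong suc toℕj≡0
  depth-parent (step i j j' toℕj'≡) = cong suc toℕj'≡

  parent-asym : ∀ {a b} → SParent l a b → SParent l b a → ⊥
  parent-asym p q = 2+n≢n (trans (sym (cong suc (depth-parent q))) (sym (depth-parent p)))
    where 2+n≢n : ∀ {n} → suc (suc n) ≢ n
          2+n≢n ()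

  parent-unique : ∀ {a b b'} → SParent l a b → SParent l a b' → b ≡ b'
  parent-unique (root i j _) (root .i .j _) = refl
  parent-unique (root i j toℕj≡0) (step .i _ .j toℕj≡) = ⊥-elim (0≢1+n (trans (sym toℕj≡0) toℕj≡))
  parent-unique (step i j j' toℕj'≡) (root .i .j' toℕj'≡0) = ⊥-elim (0≢1+n (trans (sym toℕj'≡0) toℕj'≡))
  parent-unique (step i j j' p) (step .i j₁ .j' q) = cong (λ z → inj₂ (i , z)) (Fin.toℕ-injective (suc-injective (trans (sym p) q)))

  parent-neighbour : ∀ {a b} → SParent l a b → code b ∈ neighbours (code a)
  parent-neighbour (root i j toℕj≡0) rewrite toℕj≡0 = there (there (there (here refl)))
  parent-neighbour (step i j j' toℕj'≡) rewrite toℕj'≡ = there (there (there (here refl)))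

  edge-child-neighbour : ∀ {a b} (p : SParent l a b) → edgeCode p ∈ neighbours (code a)
  edge-child-neighbour (root i j toℕj≡0) rewrite toℕj≡0 = there (there (here refl))
  edge-child-neighbour (step i j j' toℕj'≡) rewrite toℕj'≡ = there (there (here refl))

  edge-parent-neighbour : ∀ {a b} (p : SParent l a b) → edgeCode p ∈ neighbours (code b)
  edge-parent-neighbour (root i j toℕj≡0) rewrite toℕj≡0 = ∈-concatF⁺ i (here refl)
  edge-parent-neighbour (step i j j' toℕj'≡) rewrite toℕj'≡ = outward (toℕ j)
    where
    outward : ∀ t → leg i (suc (suc (double t))) ∈ neighbours (leg i (suc (double t)))
    outward zero = here refl
    outward (suc t) = here refl

  two-apart : ∀ i t → leg i (2 + t) ∈ neighbours (leg i t)
  two-apart i zero = there (here refl)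
  two-apart i (suc zero) = there (here refl)
  two-apart i (suc (suc t)) = there (here refl)

  edges-neighbours : ∀ {a b c d} (p : SParent l a b) (q : SParent l c d) → edgeCode p ≢ edgeCode q →
                     (a ≡ c ⊎ a ≡ d) ⊎ (b ≡ c ⊎ b ≡ d) → edgeCode q ∈ neighbours (edgeCode p)
  edges-neighbours p q p≢q (inj₁ (inj₁ a≡c)) =
    ⊥-elim (p≢q (cong (λ (i , j) → leg i (double (toℕ j))) (Sum.inj₂-injective (trans (sym (child-≡ p)) (trans a≡c (child-≡ q))))))
  edges-neighbours p (root i j _) p≢q (inj₁ (inj₂ a≡d)) with trans (sym (child-≡ p)) a≡d
  ... | ()
  edges-neighbours p (step i j j' _) p≢q (inj₁ (inj₂ a≡d)) with Sum.inj₂-injective (trans (sym (child-≡ p)) a≡d)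
  edges-neighbours (root i j _) (step .i .j j' toℕj'≡) p≢q (inj₁ (inj₂ a≡d)) | refl rewrite toℕj'≡ = two-apart i (double (toℕ j))
  edges-neighbours (step i _ j _) (step .i .j j' toℕj'≡) p≢q (inj₁ (inj₂ a≡d)) | refl rewrite toℕj'≡ = two-apart i (double (toℕ j))
  edges-neighbours (root i j _) q p≢q (inj₂ (inj₁ b≡c)) with trans b≡c (child-≡ q)
  ... | ()
  edges-neighbours (step i j j' _) q p≢q (inj₂ (inj₁ b≡c)) with Sum.inj₂-injective (trans b≡c (child-≡ q))
  edges-neighbours (step i j j' toℕj'≡) (root .i .j _) p≢q (inj₂ (inj₁ b≡c)) | refl rewrite toℕj'≡ = neighbours-sym (two-apart i (double (toℕ j)))
  edges-neighbours (step i j j' toℕj'≡) (step .i _ .j _) p≢q (inj₂ (inj₁ b≡c)) | refl rewrite toℕj'≡ = neighbours-sym (two-apart i (double (toℕ j)))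
  edges-neighbours (root i j p) (root i' j' q) p≢q (inj₂ (inj₂ refl)) with i Fin.≟ i'
  ... | yes refl = ⊥-elim (p≢q (cong (λ z → leg i (double (toℕ z))) (Fin.toℕ-injective (trans p (sym q)))))
  ... | no i≢i' rewrite p | q = there (there (there (∈-otherStarts⁺ (λ i'≡i → i≢i' (sym i'≡i)))))
  edges-neighbours (step i j j' p) (step .i .j j'' q) p≢q (inj₂ (inj₂ refl)) =
    ⊥-elim (p≢q (cong (λ z → leg i (double (toℕ z))) (Fin.toℕ-injective (trans p (sym q)))))

-- A star subdivision G, identified with the canonical one through φ, embeds
-- its total graph into the cells: vertices by their codes, edges by the
-- codes of their child ends.  The image is exactly the configuration n₀
-- with 2 · l i cells on leg i, and adjacency in T(G) is preserved.
module Embedding (m : ℕ) (G : Graph) (l : Fin m → ℕ) (φ : Graph.V G ↔ SV m l)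
  (adj : ∀ u v → Graph.Adj G u v ⇔ SAdj l (Inverse.to φ u) (Inverse.to φ v)) where
  open Graph G
  open Configurations m
  open StarCodes m l

  to : V → SV m l
  to = Inverse.to φ
  from : SV m l → V
  from = Inverse.from φ
  to-from : ∀ x → to (from x) ≡ x
  to-from = Inverse.strictlyInverseˡ φ
  from-to : ∀ v → from (to v) ≡ v
  from-to = Inverse.strictlyInverseʳ φ

  Ends : E → V → V → Set
  Ends e x y = (end₁ e ≡ x × end₂ e ≡ y) ⊎ (end₁ e ≡ y × end₂ e ≡ x)

  Oriented : E → Set
  Oriented e = Σ (SV m l) λ a → Σ (SV m l) λ b → SParent l a b × Ends e (from a) (from b)

  orient : ∀ e → Oriented e
  orient e with Equivalence.to (adj (end₁ e) (end₂ e)) (e , inj₁ (refl , refl))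
  ... | inj₁ p = _ , _ , p , inj₁ (sym (from-to _) , sym (from-to _))
  ... | inj₂ p = _ , _ , p , inj₂ (sym (from-to _) , sym (from-to _))

  orientation : ∀ e → SParent l (proj₁ (orient e)) (proj₁ (proj₂ (orient e)))
  orientation e = proj₁ (proj₂ (proj₂ (orient e)))

  ends-orient : ∀ e → Ends e (from (proj₁ (orient e))) (from (proj₁ (proj₂ (orient e))))
  ends-orient e = proj₂ (proj₂ (proj₂ (orient e)))

  embed : TV G → Cell m
  embed (inj₁ v) = code (to v)
  embed (inj₂ e) = edgeCode (orientation e)

  parent : ∀ i (j : Fin (l i)) → Σ (SV m l) (SParent l (inj₂ (i , j)))
  parent i j with toℕ j in toℕj≡
  ... | zero = inj₁ tt , root i j toℕj≡
  ... | suc t = inj₂ (i , fromℕ< t<l) , step i (fromℕ< t<l) j (trans toℕj≡ (cong suc (sym (Fin.toℕ-fromℕ< t<l))))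
    where t<l : t < l i
          t<l = ≤-trans (n≤1+n _) (subst (_< l i) toℕj≡ (Fin.toℕ<n j))

  parentEdgeAdj : ∀ i j → Adj (from (inj₂ (i , j))) (from (proj₁ (parent i j)))
  parentEdgeAdj i j = Equivalence.from (adj (from (inj₂ (i , j))) (from (proj₁ (parent i j))))
    (inj₁ (subst₂ (SParent l) (sym (to-from _)) (sym (to-from _)) (proj₂ (parent i j))))

  parentEdge : ∀ i → Fin (l i) → E
  parentEdge i j = proj₁ (parentEdgeAdj i j)

  ends-parentEdge : ∀ i j → Ends (parentEdge i j) (from (inj₂ (i , j))) (from (proj₁ (parent i j)))
  ends-parentEdge i j = proj₂ (parentEdgeAdj i j)

  -- reading a cell back as a vertex or an edge of G (cells outside n₀ are
  -- sent to the centre)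
  decode : Cell m → TV G
  decode centre = inj₁ (from (inj₁ tt))
  decode (leg i t) with parity t
  ... | odd a with a <? l i
  ...   | yes a<l = inj₁ (from (inj₂ (i , fromℕ< a<l)))
  ...   | no _ = inj₁ (from (inj₁ tt))
  decode (leg i t) | even a with a <? l i
  ...   | yes a<l = inj₂ (parentEdge i (fromℕ< a<l))
  ...   | no _ = inj₁ (from (inj₁ tt))

  n₀ : Config
  n₀ i = double (l i)

  embed-in : ∀ x → embed x ∈ᶜ n₀
  embed-in (inj₁ v) with to v
  ... | inj₁ tt = tt
  ... | inj₂ (i , j) = 1+double-< (Fin.toℕ<n j)
  embed-in (inj₂ e) = double-< (Fin.toℕ<n (proj₂ (child (orientation e))))

  ends-unique : ∀ {e e' x y} → Ends e x y → Ends e' x y → e ≡ e'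
  ends-unique {e} {e'} (inj₁ (p , q)) (inj₁ (r , s)) = no-multi e e' (inj₁ (trans p (sym r) , trans q (sym s)))
  ends-unique {e} {e'} (inj₁ (p , q)) (inj₂ (r , s)) = no-multi e e' (inj₂ (trans p (sym s) , trans q (sym r)))
  ends-unique {e} {e'} (inj₂ (p , q)) (inj₁ (r , s)) = no-multi e e' (inj₂ (trans p (sym s) , trans q (sym r)))
  ends-unique {e} {e'} (inj₂ (p , q)) (inj₂ (r , s)) = no-multi e e' (inj₁ (trans p (sym r) , trans q (sym s)))

  ends-match : ∀ {e x y x' y'} → Ends e x y → Ends e x' y' → (x ≡ x' × y ≡ y') ⊎ (x ≡ y' × y ≡ x')
  ends-match (inj₁ (p , q)) (inj₁ (r , s)) = inj₁ (trans (sym p) r , trans (sym q) s)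
  ends-match (inj₁ (p , q)) (inj₂ (r , s)) = inj₂ (trans (sym p) r , trans (sym q) s)
  ends-match (inj₂ (p , q)) (inj₁ (r , s)) = inj₂ (trans (sym q) s , trans (sym p) r)
  ends-match (inj₂ (p , q)) (inj₂ (r , s)) = inj₁ (trans (sym q) s , trans (sym p) r)

  parentEdge-child : ∀ e → parentEdge (proj₁ (child (orientation e))) (proj₂ (child (orientation e))) ≡ e
  parentEdge-child e = ends-unique (subst₂ (Ends (parentEdge i j)) (cong from (sym a≡)) (cong from (sym b≡)) (ends-parentEdge i j)) (ends-orient e)
    where
    p : SParent l (proj₁ (orient e)) (proj₁ (proj₂ (orient e)))
    p = orientation e
    i : Fin m
    i = proj₁ (child p)
    j : Fin (l i)
    j = proj₂ (child p)
    a≡ : proj₁ (orient e) ≡ inj₂ (i , j)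
    a≡ = child-≡ p
    b≡ : proj₁ (proj₂ (orient e)) ≡ proj₁ (parent i j)
    b≡ = parent-unique (subst (λ z → SParent l z (proj₁ (proj₂ (orient e)))) a≡ p) (proj₂ (parent i j))

  child-parentEdge : ∀ i j → child (orientation (parentEdge i j)) ≡ (i , j)
  child-parentEdge i j with ends-match (ends-orient (parentEdge i j)) (ends-parentEdge i j)
  ... | inj₁ (p , _) = Sum.inj₂-injective (trans (sym (child-≡ (orientation (parentEdge i j)))) (trans (sym (to-from _)) (trans (cong to p) (to-from _))))
  ... | inj₂ (p , q) = ⊥-elim (parent-asym (orientation (parentEdge i j))
          (subst₂ (SParent l) (trans (sym (to-from _)) (trans (cong to (sym q)) (to-from _)))
                              (trans (sym (to-from _)) (trans (cong to (sym p)) (to-from _))) (proj₂ (parent i j))))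

  decode-embed : ∀ x → decode (embed x) ≡ x
  decode-embed (inj₁ v) = trans (decode-code (to v)) (cong inj₁ (from-to v))
    where
    decode-code : ∀ a → decode (code a) ≡ inj₁ (from a)
    decode-code (inj₁ tt) = refl
    decode-code (inj₂ (i , j)) rewrite parity-odd (toℕ j) with toℕ j <? l i
    ... | yes j<l = cong (λ z → inj₁ (from (inj₂ (i , z)))) (Fin.fromℕ<-toℕ j j<l)
    ... | no j≮l = ⊥-elim (j≮l (Fin.toℕ<n j))
  decode-embed (inj₂ e) = trans (decode-edgeCode (proj₁ (child (orientation e))) (proj₂ (child (orientation e)))) (cong inj₂ (parentEdge-child e))
    where
    decode-edgeCode : ∀ i j → decode (leg i (double (toℕ j))) ≡ inj₂ (parentEdge i j)
    decode-edgeCode i j rewrite parity-even (toℕ j) with toℕ j <? l i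
    ... | yes j<l = cong (λ z → inj₂ (parentEdge i z)) (Fin.fromℕ<-toℕ j j<l)
    ... | no j≮l = ⊥-elim (j≮l (Fin.toℕ<n j))

  embed-decode : ∀ y → y ∈ᶜ n₀ → embed (decode y) ≡ y
  embed-decode centre _ = cong code (to-from (inj₁ tt))
  embed-decode (leg i t) t<n₀ with parity t
  embed-decode (leg i .(suc (double a))) t<n₀ | odd a with a <? l i
  ... | yes a<l = trans (cong code (to-from _)) (cong (λ z → leg i (suc (double z))) (Fin.toℕ-fromℕ< a<l))
  ... | no a≮l = ⊥-elim (a≮l (1+double-<⁻ t<n₀))
  embed-decode (leg i .(double a)) t<n₀ | even a with a <? l i
  ... | yes a<l = trans (cong (λ (i′ , j′) → leg i′ (double (toℕ j′))) (child-parentEdge i (fromℕ< a<l)))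
                        (cong (λ z → leg i (double z)) (Fin.toℕ-fromℕ< a<l))
  ... | no a≮l = ⊥-elim (a≮l (double-<⁻ t<n₀))

  incident-end : ∀ {v e} → Inc v e → to v ≡ proj₁ (orient e) ⊎ to v ≡ proj₁ (proj₂ (orient e))
  incident-end {v} {e} v∈e with ends-orient e | v∈e
  ... | inj₁ (p , q) | inj₁ r = inj₁ (trans (cong to (trans (sym r) p)) (to-from _))
  ... | inj₁ (p , q) | inj₂ r = inj₂ (trans (cong to (trans (sym r) q)) (to-from _))
  ... | inj₂ (p , q) | inj₁ r = inj₂ (trans (cong to (trans (sym r) p)) (to-from _))
  ... | inj₂ (p , q) | inj₂ r = inj₁ (trans (cong to (trans (sym r) q)) (to-from _))

  incident-neighbour : ∀ e v → Inc v e → edgeCode (orientation e) ∈ neighbours (code (to v))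
  incident-neighbour e v v∈e with incident-end {v} {e} v∈e
  ... | inj₁ r = subst (λ z → edgeCode (orientation e) ∈ neighbours (code z)) (sym r) (edge-child-neighbour (orientation e))
  ... | inj₂ r = subst (λ z → edgeCode (orientation e) ∈ neighbours (code z)) (sym r) (edge-parent-neighbour (orientation e))

  embed-adjacent : ∀ x y → TAdj G x y → embed y ∈ neighbours (embed x)
  embed-adjacent (inj₁ u) (inj₁ v) u~v with Equivalence.to (adj u v) u~v
  ... | inj₁ p = parent-neighbour p
  ... | inj₂ p = neighbours-sym (parent-neighbour p)
  embed-adjacent (inj₁ u) (inj₂ e) u∈e = incident-neighbour e u u∈e
  embed-adjacent (inj₂ e) (inj₁ v) v∈e = neighbours-sym (incident-neighbour e v v∈e)
  embed-adjacent (inj₂ e) (inj₂ f) (e≢f , v , v∈e , v∈f) =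
    edges-neighbours (orientation e) (orientation f) codes-differ (shared (incident-end {v} {e} v∈e) (incident-end {v} {f} v∈f))
    where
    codes-differ : edgeCode (orientation e) ≢ edgeCode (orientation f)
    codes-differ same = e≢f (Sum.inj₂-injective (trans (sym (decode-embed (inj₂ e))) (trans (cong decode same) (decode-embed (inj₂ f)))))
    shared : ∀ {X : Set} {t a b c d : X} → (t ≡ a ⊎ t ≡ b) → (t ≡ c ⊎ t ≡ d) → (a ≡ c ⊎ a ≡ d) ⊎ (b ≡ c ⊎ b ≡ d)
    shared (inj₁ p) (inj₁ q) = inj₁ (inj₁ (trans (sym p) q))
    shared (inj₁ p) (inj₂ q) = inj₁ (inj₂ (trans (sym p) q))
    shared (inj₂ p) (inj₁ q) = inj₂ (inj₁ (trans (sym p) q))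
    shared (inj₂ p) (inj₂ q) = inj₂ (inj₂ (trans (sym p) q))

Tvs-unique : ∀ G → Unique (Tvs G)
Tvs-unique G = Unique.++⁺ (Unique.map⁺ Sum.inj₁-injective (Graph.vs-unique G)) (Unique.map⁺ Sum.inj₂-injective (Graph.es-unique G))
  (λ (p , q) → let (_ , _ , p≡) = ∈-map⁻ inj₁ p ; (_ , _ , q≡) = ∈-map⁻ inj₂ q in inj₁≢inj₂ (trans (sym p≡) q≡))
  where inj₁≢inj₂ : ∀ {a b} → inj₁ a ≢ inj₂ b
        inj₁≢inj₂ ()

Tvs-complete : ∀ G x → x ∈ Tvs G
Tvs-complete G (inj₁ v) = ∈-++⁺ˡ (∈-map⁺ inj₁ (Graph.vs-complete G v))
Tvs-complete G (inj₂ e) = ∈-++⁺ʳ (map inj₁ (Graph.vs G)) (∈-map⁺ inj₂ (Graph.es-complete G e))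

-- Pull the lists back to the cells along
-- decode, colour the configuration n₀ of all codes, and read the colouring
-- off along embed.
total-star-choosable : ∀ m k → 3 ≤ k → m < k → (G : Graph) → IsStarSubdivision m G → TotalEquitablyChoosable G k
total-star-choosable m _ (s≤s (s≤s (s≤s (z≤n {d})))) m<k G (l , _ , φ , adj) L Lk =
  f , record { proper = proper ; fromList = fromList ; equitable = equitable }
  where
  open Configurations m using (size; cells; length-cells; cells-unique; ∈-cells⁻; _≟C_)
  open Embedding m G l φ adj
  open Colourings m d m<k (λ y → L (decode y)) (λ y → Lk (decode y))
  open Removals m d m<k using (capacity)
  open Ceiling (2 + d) using (⌈/⌉-mono)
  open Colouring (colouring n₀) using (colour; slot; slot<; separated)

  f : TV G → ℕ
  f x = colour (embed x)

  proper : ∀ u v → TAdj G u v → f u ≢ f v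
  proper u v u~v = Colouring.proper (colouring n₀) (embed-in u) (embed-in v) (embed-adjacent u v u~v)

  fromList : ∀ x → f x ∈ L x
  fromList x = subst (λ z → f x ∈ L z) (decode-embed x) (Colouring.fromList (colouring n₀) (embed-in x))

  -- every cell of n₀ is the code of an element of T(G)
  size≤ : size n₀ ≤ length (Tvs G)
  size≤ = begin
    size n₀                   ≡⟨ sym (length-cells n₀) ⟩
    length (cells n₀)         ≤⟨ Unique-⊆-length _≟C_ (cells-unique n₀) cells⊆ ⟩
    length (map embed (Tvs G)) ≡⟨ length-map embed (Tvs G) ⟩
    length (Tvs G)            ∎
    where
    open ≤-Reasoning
    cells⊆ : ∀ {y} → y ∈ cells n₀ → y ∈ map embed (Tvs G)
    cells⊆ {y} y∈ = subst (_∈ map embed (Tvs G)) (embed-decode y (∈-cells⁻ n₀ y∈)) (∈-map⁺ embed (Tvs-complete G (decode y)))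

  equitable : ∀ c → colourCount (Tvs G) f c ≤ ⌈ length (Tvs G) / 3 + d ⌉
  equitable c = ≤-trans
    (colour-class-bound (Tvs G) (Tvs-unique G) f (λ x → slot (embed x)) (capacity n₀) (λ {x} _ → slot< (embed-in x))
      (λ {v} {w} _ _ → embed-separated v w) c)
    (⌈/⌉-mono size≤)
    where
    -- slots separate colour classes in T(G) since embed is injective
    embed-separated : ∀ v w → slot (embed v) ≡ slot (embed w) → f v ≡ f w → v ≡ w
    embed-separated v w same-slot same = begin
      v                       ≡⟨ sym (decode-embed v) ⟩
      decode (embed v)        ≡⟨ cong decode (separated (embed-in v) (embed-in w) same-slot same) ⟩
      decode (embed w)        ≡⟨ decode-embed w ⟩
      w                       ∎
      where open ≡-Reasoning

theorem1p6 : (m : ℕ) (G : Graph) → IsStarSubdivision m G →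
    ((m ≡ 1 → (k : ℕ) → 3 ≤ k → TotalEquitablyChoosable G k) ×
     (2 ≤ m → (k : ℕ) → m + 1 ≤ k → TotalEquitablyChoosable G k))
theorem1p6 m G G-star =
  (λ m≡1 k 3≤k → total-star-choosable m k 3≤k (subst (_< k) (sym m≡1) (≤-trans (s≤s (s≤s z≤n)) 3≤k)) G G-star) ,
  (λ 2≤m k m+1≤k → total-star-choosable m k (≤-trans (+-monoˡ-≤ 1 2≤m) m+1≤k) (subst (_≤ k) (+-comm m 1) m+1≤k) G G-star)
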